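{- For any partition $\lambda$, $$R^{(+1)}(\lambda)=\sum_{x=(i,j)}(i-1)\,R(\lambda_{(x)})\,R(\lambda^{(x)}),$$ where $x$ runs through all outside corner cells of $\lambda$, lying in row $i$ and column $j$, and $\lambda_{(x)}=(\lambda_{i+1},\lambda_{i+2},\dots)$, $\lambda^{(x)}=(\lambda_1-j,\dots,\lambda_{i-1}-j)$.
   Context: A column-strict set-valued tableau of shape $\lambda$ assigns to each cell $x$ a finite nonempty set $T(x)$ of positive integers with $\max T(x)\le\min T(x')$ for $x$ left of $x'$ in a row and $\max T(x)<\min T(x')$ for $x$ above $x'$ in a column; it is a column-strict tableau if all $\#T(x)=1$, and barely set-valued if exactly one cell has two entries and all others one. It is flagged by $\varphi=(2,3,4,\dots)$ if every cell in row $i$ satisfies $\max T(x)\le i+1$. $R(\lambda)$ is the number of column-strict tableaux of shape $\lambda$ flagged by $(2,3,4,\dots)$ (equivalently the number of partitions $\mu\subseteq\lambda$; $R(\varnothing)=1$), and $R^{(+1)}(\lambda)$ is the number of column-strict barely set-valued tableaux of shape $\lambda$ flagged by $(2,3,4,\dots)$. An outside corner cell of $\lambda$ is a cell $x$ not in $\lambda$ such that $\lambda\cup\{x\}$ is a partition diagram. -}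

module Defs where

open import Data.Nat using (ℕ; zero; suc; _≤_; _<_; _∸_; _*_; _≟_; _≤?_; _<?_)
open import Data.List using (List; []; _∷_; _++_; map; concatMap; length; filter; zip; drop; take; applyUpTo; concat; sum)
open import Data.List.Relation.Unary.All using (All; all?)
open import Data.List.Relation.Unary.AllPairs using (AllPairs; allPairs?)
open import Data.List.Relation.Unary.Linked using (Linked)
open import Data.Product using (_×_; _,_; proj₁; proj₂; ∃)
open import Data.Product.Properties using ()
open import Data.Sum using (_⊎_)
open import Relation.Nullary using (Dec; yes; no)
open import Relation.Nullary.Decidable using (_×-dec_; _⊎-dec_)
open import Relation.Binary.PropositionalEquality using (_≡_)
open import Function.Bundles using (_⇔_)

-- Partitions: weakly decreasing lists of positive integers (no trailing
-- zeros).  Rows and columns are indexed from 1.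

IsPartition : List ℕ → Set
IsPartition λ′ = Linked (λ a b → b ≤ a) λ′ × All (0 <_) λ′

-- λ_i  (1-based; 0 beyond the last row and for i = 0)
row : List ℕ → ℕ → ℕ
row []       _             = 0
row (l ∷ ls) zero          = 0
row (l ∷ ls) (suc zero)    = l
row (l ∷ ls) (suc (suc k)) = row ls (suc k)

Cell : Set
Cell = ℕ × ℕ   -- (row i, column j)

InDiagram : List ℕ → Cell → Set
InDiagram λ′ (i , j) = (1 ≤ i) × (1 ≤ j) × (j ≤ row λ′ i)

IsOutsideCorner : List ℕ → Cell → Set
IsOutsideCorner λ′ x =
  (InDiagram λ′ x → Data.Empty.⊥) ×
  ∃ λ μ → IsPartition μ × (∀ c → InDiagram μ c ⇔ (InDiagram λ′ c ⊎ c ≡ x))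
  where import Data.Empty

-- Fillings.  A filling of shape λ is a list of rows, each row a list of
-- cells, each cell a finite set of positive integers represented as a
-- strictly increasing list.

Entry : Set
Entry = List ℕ

Filling : Set
Filling = List (List Entry)

subsets : List ℕ → List Entry
subsets []       = [] ∷ []
subsets (x ∷ xs) = map (x ∷_) (subsets xs) ++ subsets xs

tuples : {A : Set} → List A → ℕ → List (List A)
tuples S zero    = [] ∷ []
tuples S (suc n) = concatMap (λ s → map (s ∷_) (tuples S n)) S

-- all fillings of shape λ, starting at row index i, in which every cell of
-- row i' is a subset of {1,…,i'+1}  (this is exactly the flag (2,3,4,…))
flaggedFillingsFrom : ℕ → List ℕ → List Filling
flaggedFillingsFrom i []       = [] ∷ []
flaggedFillingsFrom i (l ∷ ls) =
  concatMap (λ r → map (r ∷_) (flaggedFillingsFrom (suc i) ls))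
            (tuples (subsets (applyUpTo suc (suc i))) l)

flaggedFillings : List ℕ → List Filling
flaggedFillings = flaggedFillingsFrom 1

NonEmptySet : Entry → Set
NonEmptySet s = 0 < length s

WeakLE : Entry → Entry → Set
WeakLE s s′ = All (λ a → All (a ≤_) s′) s

StrictLT : Entry → Entry → Set
StrictLT s s′ = All (λ a → All (a <_) s′) s

ColRel : List Entry → List Entry → Set
ColRel r r′ = All (λ p → StrictLT (proj₁ p) (proj₂ p)) (zip r r′)

IsSetValued : Filling → Set
IsSetValued T =
  All (All NonEmptySet) T ×
  All (AllPairs WeakLE) T ×
  AllPairs ColRel T

cellSizes : Filling → List ℕ
cellSizes T = concat (map (map length) T)

IsColumnStrictTableau : Filling → Set
IsColumnStrictTableau T = IsSetValued T × All (_≡ 1) (cellSizes T)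

IsBarelySetValued : Filling → Set
IsBarelySetValued T =
  IsSetValued T ×
  All (λ s → s ≡ 1 ⊎ s ≡ 2) (cellSizes T) ×
  length (filter (_≟ 2) (cellSizes T)) ≡ 1

nonEmpty? : ∀ s → Dec (NonEmptySet s)
nonEmpty? s = 0 <? length s

weakLE? : ∀ s s′ → Dec (WeakLE s s′)
weakLE? s s′ = all? (λ a → all? (a ≤?_) s′) s

strictLT? : ∀ s s′ → Dec (StrictLT s s′)
strictLT? s s′ = all? (λ a → all? (a <?_) s′) s

colRel? : ∀ r r′ → Dec (ColRel r r′)
colRel? r r′ = all? (λ p → strictLT? (proj₁ p) (proj₂ p)) (zip r r′)

isSetValued? : ∀ T → Dec (IsSetValued T)
isSetValued? T =
  all? (all? nonEmpty?) T ×-dec (all? (allPairs? weakLE?) T ×-dec allPairs? colRel? T)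

isCST? : ∀ T → Dec (IsColumnStrictTableau T)
isCST? T = isSetValued? T ×-dec all? (_≟ 1) (cellSizes T)

isBarely? : ∀ T → Dec (IsBarelySetValued T)
isBarely? T = isSetValued? T ×-dec
  (all? (λ s → (s ≟ 1) ⊎-dec (s ≟ 2)) (cellSizes T) ×-dec
   (length (filter (_≟ 2) (cellSizes T)) ≟ 1))

R : List ℕ → ℕ
R λ′ = length (filter isCST? (flaggedFillings λ′))

R⁺¹ : List ℕ → ℕ
R⁺¹ λ′ = length (filter isBarely? (flaggedFillings λ′))

lowerPart : List ℕ → Cell → List ℕ
lowerPart λ′ (i , j) = drop i λ′

upperPart : List ℕ → Cell → List ℕ
upperPart λ′ (i , j) = map (_∸ j) (take (i ∸ 1) λ′)

cornerTerm : List ℕ → Cell → ℕ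
cornerTerm λ′ x = (proj₁ x ∸ 1) * R (lowerPart λ′ x) * R (upperPart λ′ x)

-- In a column-strict tableau flagged by (2,3,4,…) every entry of row i is i or
-- i + 1, so the tableau is determined by the numbers k_i of entries equal to i,
-- and column strictness says exactly k_1 ≥ k_2 ≥ …; in the barely set-valued case
-- the one two-element cell {i, i + 1} sits right after the k_i copies of i.  Both
-- counts therefore become iterated sums over the first row.  Deleting one row of
-- λ gives count⁺¹(λ) + Σ_k count(λ minus row k) = ℓ(λ) count(λ), and deleting row
-- i instead of row i - 1 adds precisely the tableaux attached to the outside
-- corner x in row i, which split into R(λ_(x)) R(λ^(x)).  Telescoping, that corner
-- is counted i - 1 times.

module Submission where

open import Defs
open import Data.Nat
open import Data.Nat.Properties
open import Algebra.Properties.CommutativeSemigroup +-commutativeSemigroup using (interchange)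
open import Data.List
  using (List; []; _∷_; _++_; length; map; filter; drop; take; concatMap; applyUpTo; upTo; cartesianProductWith)
open import Data.List.Properties using (map-++; map-∘; ∷-injective; length-++; filter-++; filter-none)
open import Data.Nat.ListAction using (sum)
open import Data.Nat.ListAction.Properties using (sum-++; sum-↭)
open import Data.List.Membership.Propositional using (_∈_)
open import Data.List.Membership.Propositional.Properties
  using ( ∈-cartesianProductWith⁺; ∈-cartesianProductWith⁻; ∈-map⁺; ∈-map⁻; ∈-++⁺ˡ; ∈-++⁺ʳ; ∈-++⁻
        ; ∈-applyUpTo⁻; ∈-applyUpTo⁺; ∈-filter⁺; ∈-filter⁻; ∈-upTo⁺; ∈-upTo⁻)
open import Data.List.Membership.Propositional.Properties.WithK using (unique∧set⇒bag)
open import Data.List.Relation.Binary.BagAndSetEquality using (∼bag⇒↭)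
open import Data.List.Relation.Binary.Permutation.Propositional.Properties using () renaming (map⁺ to ↭-map⁺)
open import Data.List.Relation.Unary.Any using (here; there)
open import Data.List.Relation.Unary.All as All using (All; []; _∷_; all?)
open import Data.List.Relation.Unary.All.Properties
  using () renaming (++⁺ to all-++⁺; ++⁻ to all-++⁻; map⁺ to all-map⁺; map⁻ to all-map⁻)
open import Data.List.Relation.Unary.Unique.Propositional using (Unique)
open import Data.List.Relation.Unary.Unique.Propositional.Properties
  using (cartesianProductWith⁺; filter⁺; applyUpTo⁺₁; upTo⁺) renaming (++⁺ to unique-++⁺; map⁺ to unique-map⁺)
open import Data.List.Relation.Unary.AllPairs using (AllPairs; []; _∷_; allPairs?)
import Data.List.Relation.Unary.AllPairs.Properties as AllPairs
open import Data.List.Relation.Binary.Sublist.Propositional using (_⊆_; []; _∷ʳ_; _∷_; minimum)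
open import Data.Product using (_×_; _,_; proj₁; proj₂; ∃)
open import Data.Sum using (_⊎_; inj₁; inj₂)
open import Function.Bundles using (_⇔_; mk⇔; Equivalence)
open import Function.Properties.Equivalence using () renaming (sym to ⇔-sym; trans to ⇔-trans)
open import Data.List.Relation.Unary.Linked as Linked using (Linked; []; [-]; _∷_)
open import Data.List.Relation.Unary.Linked.Properties using (Linked⇒All) renaming (map⁺ to linked-map⁺)
open import Relation.Nullary using (Dec; yes; no; ¬_)
open import Relation.Nullary.Decidable using (_×-dec_; _⊎-dec_)
open import Relation.Binary.PropositionalEquality
open import Function using (_∘_; id)
open import Data.Empty using (⊥; ⊥-elim)
open import Data.Unit using (⊤; tt)

∑ : ℕ → (ℕ → ℕ) → ℕ
∑ zero    f = 0
∑ (suc n) f = f 0 + ∑ n (f ∘ suc)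

∑-cong : ∀ n {f g : ℕ → ℕ} → (∀ k → k < n → f k ≡ g k) → ∑ n f ≡ ∑ n g
∑-cong zero    f≡g = refl
∑-cong (suc n) f≡g = cong₂ _+_ (f≡g 0 z<s) (∑-cong n (λ k k<n → f≡g (suc k) (s<s k<n)))

∑-0 : ∀ n {f : ℕ → ℕ} → (∀ k → k < n → f k ≡ 0) → ∑ n f ≡ 0
∑-0 zero    f≡0 = refl
∑-0 (suc n) f≡0 = cong₂ _+_ (f≡0 0 z<s) (∑-0 n (λ k k<n → f≡0 (suc k) (s<s k<n)))

∑-const : ∀ n c → ∑ n (λ _ → c) ≡ n * c
∑-const zero    c = refl
∑-const (suc n) c = cong (c +_) (∑-const n c)

∑-+ : ∀ n (f g : ℕ → ℕ) → ∑ n (λ k → f k + g k) ≡ ∑ n f + ∑ n g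
∑-+ zero    f g = refl
∑-+ (suc n) f g = trans (cong (f 0 + g 0 +_) (∑-+ n (f ∘ suc) (g ∘ suc)))
                        (interchange (f 0) (g 0) _ _)

∑-*ˡ : ∀ n c (f : ℕ → ℕ) → ∑ n (λ k → c * f k) ≡ c * ∑ n f
∑-*ˡ zero    c f = sym (*-zeroʳ c)
∑-*ˡ (suc n) c f = trans (cong (c * f 0 +_) (∑-*ˡ n c (f ∘ suc)))
                         (sym (*-distribˡ-+ c (f 0) _))

∑-split : ∀ a b (f : ℕ → ℕ) → ∑ (a + b) f ≡ ∑ a f + ∑ b (λ k → f (a + k))
∑-split zero    b f = refl
∑-split (suc a) b f = trans (cong (f 0 +_) (∑-split a b (f ∘ suc))) (sym (+-assoc (f 0) _ _))

∑-last : ∀ n (f : ℕ → ℕ) → ∑ (suc n) f ≡ ∑ n f + f n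
∑-last n f = begin
  ∑ (suc n) f                  ≡⟨ cong (λ k → ∑ k f) (+-comm 1 n) ⟩
  ∑ (n + 1) f                  ≡⟨ ∑-split n 1 f ⟩
  ∑ n f + (f (n + 0) + 0)      ≡⟨ cong (λ k → ∑ n f + k) (trans (+-identityʳ _) (cong f (+-identityʳ n))) ⟩
  ∑ n f + f n                  ∎
  where open ≡-Reasoning

∑-swap : ∀ n p (f : ℕ → ℕ → ℕ) → ∑ n (λ i → ∑ p (f i)) ≡ ∑ p (λ j → ∑ n (λ i → f i j))
∑-swap zero    p f = sym (∑-0 p (λ _ _ → refl))
∑-swap (suc n) p f = trans (cong (∑ p (f 0) +_) (∑-swap n p (f ∘ suc)))
                           (sym (∑-+ p (f 0) (λ j → ∑ n (λ i → f (suc i) j))))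

∑-triangle : ∀ n (f : ℕ → ℕ) → ∑ n (λ k → ∑ (n ∸ k) (λ t → f (k + t))) ≡ ∑ n (λ u → suc u * f u)
∑-triangle zero    f = refl
∑-triangle (suc n) f = begin
  ∑ (suc n) f + ∑ n (λ k → ∑ (n ∸ k) (λ t → f (suc k + t)))
    ≡⟨ cong (∑ (suc n) f +_) (∑-triangle n (f ∘ suc)) ⟩
  f 0 + ∑ n (f ∘ suc) + ∑ n (λ u → suc u * f (suc u))
    ≡⟨ +-assoc (f 0) _ _ ⟩
  f 0 + (∑ n (f ∘ suc) + ∑ n (λ u → suc u * f (suc u)))
    ≡⟨ cong₂ _+_ (sym (+-identityʳ (f 0))) (sym (∑-+ n (f ∘ suc) (λ u → suc u * f (suc u)))) ⟩
  ∑ (suc n) (λ u → suc u * f u) ∎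
  where open ≡-Reasoning

χ : ∀ {P : Set} → Dec P → ℕ
χ (yes _) = 1
χ (no _)  = 0

χ-yes : ∀ {P : Set} (P? : Dec P) → P → χ P? ≡ 1
χ-yes (yes _) _ = refl
χ-yes (no ¬p) p = ⊥-elim (¬p p)

χ-no : ∀ {P : Set} (P? : Dec P) → ¬ P → χ P? ≡ 0
χ-no (yes p) ¬p = ⊥-elim (¬p p)
χ-no (no _)  _  = refl

χ-⇔ : ∀ {P P′ : Set} (P? : Dec P) (P′? : Dec P′) → (P ⇔ P′) → χ P? ≡ χ P′?
χ-⇔ (yes p) (yes _)  e = refl
χ-⇔ (yes p) (no ¬p′) e = ⊥-elim (¬p′ (Equivalence.to e p))
χ-⇔ (no ¬p) (yes p′) e = ⊥-elim (¬p (Equivalence.from e p′))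
χ-⇔ (no _)  (no _)   e = refl

χ-×-dec : ∀ {P P′ : Set} (P? : Dec P) (P′? : Dec P′) → χ (P? ×-dec P′?) ≡ χ P? * χ P′?
χ-×-dec (yes _) (yes _) = refl
χ-×-dec (yes _) (no _)  = refl
χ-×-dec (no _)  (yes _) = refl
χ-×-dec (no _)  (no _)  = refl

χ-⊎-dec : ∀ {P P′ : Set} (P? : Dec P) (P′? : Dec P′) → ¬ (P × P′) → χ (P? ⊎-dec P′?) ≡ χ P? + χ P′?
χ-⊎-dec (yes p) (yes p′) ¬both = ⊥-elim (¬both (p , p′))
χ-⊎-dec (yes _) (no _)   ¬both = refl
χ-⊎-dec (no _)  (yes _)  ¬both = refl
χ-⊎-dec (no _)  (no _)   ¬both = refl

χ*-∑ : ∀ {P : Set} (P? : Dec P) n x (f : ℕ → ℕ) → (P → x ≡ ∑ n f) → χ P? * x ≡ ∑ n (λ c → χ P? * f c)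
χ*-∑ (yes p) n x f x≡ = trans (*-identityˡ x) (trans (x≡ p) (∑-cong n (λ c _ → sym (*-identityˡ (f c)))))
χ*-∑ (no _)  n x f x≡ = sym (∑-0 n (λ _ _ → refl))

module _ {A : Set} where

  length-filter≡sum-χ : {P : A → Set} (P? : ∀ x → Dec (P x)) (xs : List A) →
    length (filter P? xs) ≡ sum (map (χ ∘ P?) xs)
  length-filter≡sum-χ P? []       = refl
  length-filter≡sum-χ P? (x ∷ xs) with P? x
  ... | yes _ = cong suc (length-filter≡sum-χ P? xs)
  ... | no _  = length-filter≡sum-χ P? xs

  sum-map-cong : ∀ xs {f g : A → ℕ} → (∀ x → x ∈ xs → f x ≡ g x) → sum (map f xs) ≡ sum (map g xs)
  sum-map-cong []       f≡g = refl
  sum-map-cong (x ∷ xs) f≡g = cong₂ _+_ (f≡g x (here refl)) (sum-map-cong xs (λ y y∈ → f≡g y (there y∈)))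

  sum-map-+ : ∀ xs (f g : A → ℕ) → sum (map (λ x → f x + g x) xs) ≡ sum (map f xs) + sum (map g xs)
  sum-map-+ []       f g = refl
  sum-map-+ (x ∷ xs) f g = trans (cong (f x + g x +_) (sum-map-+ xs f g)) (interchange (f x) (g x) _ _)

  sum-map-*ˡ : ∀ xs c (f : A → ℕ) → sum (map (λ x → c * f x) xs) ≡ c * sum (map f xs)
  sum-map-*ˡ []       c f = sym (*-zeroʳ c)
  sum-map-*ˡ (x ∷ xs) c f = trans (cong (c * f x +_) (sum-map-*ˡ xs c f)) (sym (*-distribˡ-+ c (f x) _))

  sum-map-χ* : {P : A → Set} (P? : ∀ x → Dec (P x)) (xs : List A) (f : A → ℕ) →
    sum (map (λ x → χ (P? x) * f x) xs) ≡ sum (map f (filter P? xs))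
  sum-map-χ* P? []       f = refl
  sum-map-χ* P? (x ∷ xs) f with P? x
  ... | yes _ = cong₂ _+_ (+-identityʳ (f x)) (sum-map-χ* P? xs f)
  ... | no _  = sum-map-χ* P? xs f

  sum-map-applyUpTo : ∀ (h : ℕ → A) n (f : A → ℕ) → sum (map f (applyUpTo h n)) ≡ ∑ n (f ∘ h)
  sum-map-applyUpTo h zero    f = refl
  sum-map-applyUpTo h (suc n) f = cong (f (h 0) +_) (sum-map-applyUpTo (h ∘ suc) n f)

  -- Two duplicate-free lists with the same elements are permutations of each other.
  sum-map-setEq : ∀ xs ys (f : A → ℕ) → Unique xs → Unique ys → (∀ x → x ∈ xs ⇔ x ∈ ys) →
    sum (map f xs) ≡ sum (map f ys)
  sum-map-setEq xs ys f xs! ys! xs≈ys =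
    sum-↭ (↭-map⁺ f (∼bag⇒↭ (unique∧set⇒bag xs! ys! (λ {x} → xs≈ys x))))

  conses : List A → List (List A) → List (List A)
  conses = cartesianProductWith _∷_

  concatMap-conses : ∀ S T → concatMap (λ s → map (s ∷_) T) S ≡ conses S T
  concatMap-conses []      T = refl
  concatMap-conses (s ∷ S) T = cong (map (s ∷_) T ++_) (concatMap-conses S T)

  sum-map-conses : ∀ S T (h : List A → ℕ) →
    sum (map h (conses S T)) ≡ sum (map (λ s → sum (map h (map (s ∷_) T))) S)
  sum-map-conses []      T h = refl
  sum-map-conses (s ∷ S) T h = begin
    sum (map h (map (s ∷_) T ++ conses S T))
      ≡⟨ cong sum (map-++ h (map (s ∷_) T) (conses S T)) ⟩
    sum (map h (map (s ∷_) T) ++ map h (conses S T))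
      ≡⟨ sum-++ (map h (map (s ∷_) T)) _ ⟩
    sum (map h (map (s ∷_) T)) + sum (map h (conses S T))
      ≡⟨ cong (sum (map h (map (s ∷_) T)) +_) (sum-map-conses S T h) ⟩
    sum (map h (map (s ∷_) T)) + sum (map (λ s → sum (map h (map (s ∷_) T))) S) ∎
    where open ≡-Reasoning

  ∈-tuples⁻ : ∀ S n {r} → r ∈ tuples S n → length r ≡ n × All (_∈ S) r
  ∈-tuples⁻ S zero    (here refl) = refl , []
  ∈-tuples⁻ S (suc n) r∈
    with s , t , s∈ , t∈ , refl ← ∈-cartesianProductWith⁻ _∷_ S (tuples S n) (subst (_ ∈_) (concatMap-conses S _) r∈)
    with |t|≡n , t⊆S ← ∈-tuples⁻ S n t∈
    = cong suc |t|≡n , s∈ ∷ t⊆S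

  ∈-tuples⁺ : ∀ S r → All (_∈ S) r → r ∈ tuples S (length r)
  ∈-tuples⁺ S []      []         = here refl
  ∈-tuples⁺ S (s ∷ r) (s∈ ∷ r⊆S) =
    subst (_ ∈_) (sym (concatMap-conses S _)) (∈-cartesianProductWith⁺ _∷_ s∈ (∈-tuples⁺ S r r⊆S))

  tuples-unique : ∀ S n → Unique S → Unique (tuples S n)
  tuples-unique S zero    S! = [] ∷ []
  tuples-unique S (suc n) S! = subst Unique (sym (concatMap-conses S _))
    (cartesianProductWith⁺ _∷_ ∷-injective S! (tuples-unique S n S!))

∈-subsets⁻ : ∀ xs {s} → s ∈ subsets xs → All (_∈ xs) s
∈-subsets⁻ []       (here refl) = []
∈-subsets⁻ (x ∷ xs) s∈ with ∈-++⁻ (map (x ∷_) (subsets xs)) s∈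
... | inj₁ s∈x∷ with t , t∈ , refl ← ∈-map⁻ (x ∷_) s∈x∷ = here refl ∷ All.map there (∈-subsets⁻ xs t∈)
... | inj₂ s∈′ = All.map there (∈-subsets⁻ xs s∈′)

subsets-sorted : ∀ xs {s} → AllPairs _<_ xs → s ∈ subsets xs → AllPairs _<_ s
subsets-sorted []       _           (here refl) = []
subsets-sorted (x ∷ xs) (x< ∷ xs<) s∈ with ∈-++⁻ (map (x ∷_) (subsets xs)) s∈
... | inj₁ s∈x∷ with t , t∈ , refl ← ∈-map⁻ (x ∷_) s∈x∷ =
  All.map (All.lookup x<) (∈-subsets⁻ xs t∈) ∷ subsets-sorted xs xs< t∈
... | inj₂ s∈′ = subsets-sorted xs xs< s∈′

subsets-unique : ∀ xs → AllPairs _<_ xs → Unique (subsets xs)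
subsets-unique []       _          = [] ∷ []
subsets-unique (x ∷ xs) (x< ∷ xs<) =
  unique-++⁺ (unique-map⁺ (proj₂ ∘ ∷-injective) (subsets-unique xs xs<)) (subsets-unique xs xs<) disjoint
  where
  disjoint : ∀ {v} → ¬ (v ∈ map (x ∷_) (subsets xs) × v ∈ subsets xs)
  disjoint (v∈x∷ , v∈) with t , _ , refl ← ∈-map⁻ (x ∷_) v∈x∷ with x∈ ∷ _ ← ∈-subsets⁻ xs v∈ =
    <-irrefl refl (All.lookup x< x∈)

∈-subsets⁺ : ∀ {s xs} → s ⊆ xs → s ∈ subsets xs
∈-subsets⁺ []                     = here refl
∈-subsets⁺ {xs = x ∷ xs} (_ ∷ʳ s⊆) = ∈-++⁺ʳ (map (x ∷_) (subsets xs)) (∈-subsets⁺ s⊆)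
∈-subsets⁺ (refl ∷ s⊆)            = ∈-++⁺ˡ (∈-map⁺ _ (∈-subsets⁺ s⊆))

[f_k]⊆applyUpTo : ∀ (f : ℕ → ℕ) n k → k < n → f k ∷ [] ⊆ applyUpTo f n
[f_k]⊆applyUpTo f (suc n) zero    _       = refl ∷ minimum _
[f_k]⊆applyUpTo f (suc n) (suc k) (s<s k<n) = f 0 ∷ʳ [f_k]⊆applyUpTo (f ∘ suc) n k k<n

[f_k,f_k+1]⊆applyUpTo : ∀ (f : ℕ → ℕ) n k → suc k < n → f k ∷ f (suc k) ∷ [] ⊆ applyUpTo f n
[f_k,f_k+1]⊆applyUpTo f (suc (suc n)) zero    _         = refl ∷ refl ∷ minimum _
[f_k,f_k+1]⊆applyUpTo f (suc n)       (suc k) (s<s k<n) = f 0 ∷ʳ [f_k,f_k+1]⊆applyUpTo (f ∘ suc) n k k<n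

Decreasing : List ℕ → Set
Decreasing = Linked _≥_

decreasing-next : ∀ {l ls} → Decreasing (l ∷ ls) → row ls 1 ≤ l
decreasing-next [-]     = z≤n
decreasing-next (h ∷ _) = h

∷-decreasing : ∀ {x xs} → Decreasing xs → row xs 1 ≤ x → Decreasing (x ∷ xs)
∷-decreasing {xs = []}    _ _   = [-]
∷-decreasing {xs = _ ∷ _} d x≥ = x≥ ∷ d

decreasing⇒≤head : ∀ {l ls} → Decreasing (l ∷ ls) → All (_≤ l) (l ∷ ls)
decreasing⇒≤head = Linked⇒All (λ p q → ≤-trans q p) ≤-refl

≤row-1 : ∀ λ′ → Decreasing λ′ → All (_≤ row λ′ 1) λ′
≤row-1 []       _ = []
≤row-1 (l ∷ ls) d = decreasing⇒≤head d

row≤row-1 : ∀ ls k → Decreasing ls → row ls k ≤ row ls 1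
row≤row-1 []       k             d = z≤n
row≤row-1 (l ∷ ls) zero          d = z≤n
row≤row-1 (l ∷ ls) (suc zero)    d = ≤-refl
row≤row-1 (l ∷ ls) (suc (suc k)) d =
  ≤-trans (row≤row-1 ls (suc k) (Linked.tail d)) (decreasing-next d)

row-suc-≤ : ∀ μ → Decreasing μ → ∀ u → row μ (2 + u) ≤ row μ (suc u)
row-suc-≤ []       d u       = z≤n
row-suc-≤ (x ∷ xs) d zero    = decreasing-next d
row-suc-≤ (x ∷ xs) d (suc u) = row-suc-≤ xs (Linked.tail d) u

row-beyond : ∀ λ′ k → length λ′ ≤ k → row λ′ (suc k) ≡ 0
row-beyond []       k       _         = refl
row-beyond (x ∷ xs) (suc k) (s≤s |xs|) = row-beyond xs k |xs|

drop-decreasing : ∀ n λ′ → Decreasing λ′ → Decreasing (drop n λ′)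
drop-decreasing zero    λ′       d = d
drop-decreasing (suc n) []       d = []
drop-decreasing (suc n) (x ∷ xs) d = drop-decreasing n xs (Linked.tail d)

row-1-take : ∀ n xs → row (take n xs) 1 ≤ row xs 1
row-1-take zero    xs       = z≤n
row-1-take (suc n) []       = z≤n
row-1-take (suc n) (x ∷ xs) = ≤-refl

take-decreasing : ∀ n λ′ → Decreasing λ′ → Decreasing (take n λ′)
take-decreasing zero    λ′       d = []
take-decreasing (suc n) []       d = []
take-decreasing (suc n) (x ∷ xs) d =
  ∷-decreasing (take-decreasing n xs (Linked.tail d)) (≤-trans (row-1-take n xs) (decreasing-next d))

∸-decreasing : ∀ j λ′ → Decreasing λ′ → Decreasing (map (_∸ j) λ′)
∸-decreasing j λ′ d = linked-map⁺ (Linked.map (∸-monoˡ-≤ j) d)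

-- Counting subpartitions row by row

-- Row i of a flagged column-strict tableau is i^k (i+1)^(λ_i - k), and column
-- strictness says exactly that k does not increase from one row to the next.
-- So count m λ is the number of such tableaux whose first row has at most m
-- entries equal to 1, i.e. the number of partitions μ ⊆ λ with μ_1 ≤ m.
count : ℕ → List ℕ → ℕ
count m []       = 1
count m (l ∷ ls) = ∑ (suc (m ⊓ l)) (λ k → count k ls)

-- In the barely set-valued case the two-element cell {i, i+1} of row i sits
-- right after the k copies of i, which forces k < λ_i and caps the next row at k.
count⁺¹ : ℕ → List ℕ → ℕ
count⁺¹ m []       = 0
count⁺¹ m (l ∷ ls) = ∑ (m ⊓ l) (λ k → count k ls) + ∑ (suc (m ⊓ l)) (λ k → count⁺¹ k ls)

countUncapped : List ℕ → ℕ
countUncapped λ′ = count (row λ′ 1) λ′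

count-cap : ∀ m m′ ls → m ⊓ row ls 1 ≡ m′ ⊓ row ls 1 → count m ls ≡ count m′ ls
count-cap m m′ []       e = refl
count-cap m m′ (l ∷ ls) e = cong (λ c → ∑ (suc c) (λ k → count k ls)) e

count-uncapped : ∀ m ls → row ls 1 ≤ m → count m ls ≡ countUncapped ls
count-uncapped m ls h = count-cap m (row ls 1) ls (trans (m≥n⇒m⊓n≡n h) (sym (⊓-idem (row ls 1))))

count-singleton : ∀ m l → count m (l ∷ []) ≡ suc (m ⊓ l)
count-singleton m l = trans (∑-const (suc (m ⊓ l)) 1) (*-identityʳ _)

deleteRow : ℕ → List ℕ → List ℕ
deleteRow _             []       = []
deleteRow zero          xs       = xs
deleteRow (suc zero)    (x ∷ xs) = xs
deleteRow (suc (suc k)) (x ∷ xs) = x ∷ deleteRow (suc k) xs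

deleteRow-beyond : ∀ λ′ → deleteRow (suc (length λ′)) λ′ ≡ λ′
deleteRow-beyond []       = refl
deleteRow-beyond (l ∷ ls) = cong (l ∷_) (deleteRow-beyond ls)

∑count-deleteRow : ℕ → List ℕ → ℕ
∑count-deleteRow m λ′ = ∑ (length λ′) (λ k → count m (deleteRow (suc k) λ′))

-- After expanding the first row, deleting that row supplies the missing term
-- k = m ⊓ l of the first sum in count⁺¹; the remaining terms are the induction
-- hypothesis summed over the cap of the next row.
count⁺¹+∑deleteRow≡length*count : ∀ m λ′ → Decreasing λ′ →
  count⁺¹ m λ′ + ∑count-deleteRow m λ′ ≡ length λ′ * count m λ′
count⁺¹+∑deleteRow≡length*count m []       d = refl
count⁺¹+∑deleteRow≡length*count m (l ∷ ls) d = begin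
  (SQa + SE) + (count m ls + SS)  ≡⟨ cong (λ z → (SQa + SE) + (z + SS)) capped ⟩
  (SQa + SE) + (count a ls + SS)  ≡⟨ interchange SQa SE (count a ls) SS ⟩
  (SQa + count a ls) + (SE + SS)  ≡⟨ cong₂ _+_ (sym (∑-last a (λ k → count k ls))) rest ⟩
  SQ + L * SQ                     ∎
  where
  open ≡-Reasoning
  a = m ⊓ l
  L = length ls
  SQa = ∑ a (λ k → count k ls)
  SQ = ∑ (suc a) (λ k → count k ls)
  SE = ∑ (suc a) (λ k → count⁺¹ k ls)
  SS = ∑ L (λ k → ∑ (suc a) (λ c → count c (deleteRow (suc k) ls)))
  capped : count m ls ≡ count a ls
  capped = count-cap m a ls (begin
    m ⊓ row ls 1        ≡⟨ cong (m ⊓_) (sym (m≤n⇒m⊓n≡m (decreasing-next d))) ⟩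
    m ⊓ (row ls 1 ⊓ l)  ≡⟨ cong (m ⊓_) (⊓-comm (row ls 1) l) ⟩
    m ⊓ (l ⊓ row ls 1)  ≡⟨ sym (⊓-assoc m l (row ls 1)) ⟩
    a ⊓ row ls 1        ∎)
  rest : SE + SS ≡ L * SQ
  rest = begin
    SE + SS
      ≡⟨ cong (SE +_) (∑-swap L (suc a) (λ k c → count c (deleteRow (suc k) ls))) ⟩
    SE + ∑ (suc a) (λ c → ∑count-deleteRow c ls)
      ≡⟨ sym (∑-+ (suc a) (λ k → count⁺¹ k ls) (λ c → ∑count-deleteRow c ls)) ⟩
    ∑ (suc a) (λ c → count⁺¹ c ls + ∑count-deleteRow c ls)
      ≡⟨ ∑-cong (suc a) (λ c _ → count⁺¹+∑deleteRow≡length*count c ls (Linked.tail d)) ⟩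
    ∑ (suc a) (λ c → L * count c ls)
      ≡⟨ ∑-*ˡ (suc a) L (λ c → count c ls) ⟩
    L * SQ ∎

-- The contribution of the outside corner in row i ≥ 2 (column λ_i + 1) when the
-- first row is capped at m: the rows below it form an arbitrary subpartition,
-- the rows above it one of (λ_1 - j, …, λ_{i-1} - j) capped at m - j.
cornerCount : ℕ → ℕ → List ℕ → ℕ
cornerCount i m λ′ = χ (r <? row λ′ (pred i)) *
  (χ (r <? m) * (countUncapped (drop i λ′) * count (m ∸ suc r) (map (_∸ suc r) (take (pred i) λ′))))
  where r = row λ′ i

∸-suc : ∀ {h a} → h < a → suc (a ∸ suc h) ≡ a ∸ h
∸-suc {h} {a} h<a = sym (+-∸-assoc 1 h<a)

suc-⊓-∸ : ∀ m l h → h < m → h < l → suc ((m ∸ suc h) ⊓ (l ∸ suc h)) ≡ (m ⊓ l) ∸ h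
suc-⊓-∸ m l h h<m h<l = trans (cong suc (sym (∸-distribʳ-⊓ (suc h) m l))) (∸-suc (⊓-glb h<m h<l))

∑count-beyond : ∀ a h t → row t 1 ≤ h → h ≤ a →
  ∑ (suc a) (λ c → count c t) ≡ ∑ (suc h) (λ c → count c t) + (a ∸ h) * countUncapped t
∑count-beyond a h t t≤h h≤a = begin
  ∑ (suc a) f                                  ≡⟨ cong (λ z → ∑ z f) (sym (cong suc (m+[n∸m]≡n h≤a))) ⟩
  ∑ (suc h + (a ∸ h)) f                        ≡⟨ ∑-split (suc h) (a ∸ h) f ⟩
  ∑ (suc h) f + ∑ (a ∸ h) (λ k → f (suc h + k)) ≡⟨ cong (∑ (suc h) f +_) (∑-cong (a ∸ h) uncapped) ⟩
  ∑ (suc h) f + ∑ (a ∸ h) (λ _ → countUncapped t) ≡⟨ cong (∑ (suc h) f +_) (∑-const (a ∸ h) _) ⟩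
  ∑ (suc h) f + (a ∸ h) * countUncapped t       ∎
  where
  open ≡-Reasoning
  f = λ c → count c t
  uncapped : ∀ k → k < a ∸ h → f (suc h + k) ≡ countUncapped t
  uncapped k _ = count-uncapped (suc h + k) t (≤-trans t≤h (≤-trans (n≤1+n h) (m≤m+n (suc h) k)))

-- count m (l ∷ t) exceeds count m (h ∷ t) by the caps h < k ≤ m ⊓ l of the
-- first row, under each of which t is uncapped.
count-deleteRow-2 : ∀ m λ′ → Decreasing λ′ →
  count m (deleteRow 2 λ′) ≡ count m (deleteRow 1 λ′) + cornerCount 2 m λ′
count-deleteRow-2 m       []             d = refl
count-deleteRow-2 zero    (zero ∷ [])    d = refl
count-deleteRow-2 zero    (suc l ∷ [])   d = refl
count-deleteRow-2 (suc m) (zero ∷ [])    d = refl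
count-deleteRow-2 (suc m) (suc l ∷ [])   d = begin
  count (suc m) (suc l ∷ [])             ≡⟨ count-singleton (suc m) (suc l) ⟩
  suc (suc (m ⊓ l))                      ≡⟨ cong suc (sym (count-singleton m l)) ⟩
  suc (count m (l ∷ []))                 ≡⟨ cong suc (sym (trans (*-identityˡ _) (trans (*-identityˡ _) (*-identityˡ _)))) ⟩
  suc (1 * (1 * (1 * count m (l ∷ [])))) ∎
  where open ≡-Reasoning
count-deleteRow-2 m (l ∷ h ∷ t) d with h <? l | h <? m
... | no h≮l | _ = begin
  count m (l ∷ t)     ≡⟨ cong (λ z → count m (z ∷ t)) (≤-antisym (≮⇒≥ h≮l) (decreasing-next d)) ⟩
  count m (h ∷ t)     ≡⟨ sym (+-identityʳ _) ⟩
  count m (h ∷ t) + 0 ∎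
  where open ≡-Reasoning
... | yes h<l | no h≮m = begin
  count m (l ∷ t)         ≡⟨ cong (λ c → ∑ (suc c) (λ k → count k t)) m⊓l≡m⊓h ⟩
  count m (h ∷ t)         ≡⟨ sym (+-identityʳ _) ⟩
  count m (h ∷ t) + 1 * 0 ∎
  where
  open ≡-Reasoning
  m≤h = ≮⇒≥ h≮m
  m⊓l≡m⊓h : m ⊓ l ≡ m ⊓ h
  m⊓l≡m⊓h = trans (m≤n⇒m⊓n≡m (≤-trans m≤h (decreasing-next d))) (sym (m≤n⇒m⊓n≡m m≤h))
... | yes h<l | yes h<m = begin
  count m (l ∷ t)
    ≡⟨ ∑count-beyond (m ⊓ l) h t (decreasing-next (Linked.tail d)) (<⇒≤ (⊓-glb h<m h<l)) ⟩
  ∑ (suc h) (λ c → count c t) + (m ⊓ l ∸ h) * countUncapped t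
    ≡⟨ cong₂ (λ u v → ∑ (suc u) (λ c → count c t) + v) (sym (m≥n⇒m⊓n≡n (<⇒≤ h<m))) (*-comm (m ⊓ l ∸ h) _) ⟩
  count m (h ∷ t) + countUncapped t * (m ⊓ l ∸ h)
    ≡⟨ cong (λ z → count m (h ∷ t) + countUncapped t * z) (sym above) ⟩
  count m (h ∷ t) + countUncapped t * count (m ∸ suc h) ((l ∸ suc h) ∷ [])
    ≡⟨ cong (count m (h ∷ t) +_) (sym (trans (*-identityˡ _) (*-identityˡ _))) ⟩
  count m (h ∷ t) + 1 * (1 * (countUncapped t * count (m ∸ suc h) ((l ∸ suc h) ∷ []))) ∎
  where
  open ≡-Reasoning
  above : count (m ∸ suc h) ((l ∸ suc h) ∷ []) ≡ m ⊓ l ∸ h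
  above = trans (count-singleton (m ∸ suc h) (l ∸ suc h)) (suc-⊓-∸ m l h h<m h<l)

-- Shifting the cap: the terms c ≤ r of the right-hand sum vanish.
χ*∑-shift : ∀ r m l (f : ℕ → ℕ) → r < l →
  χ (r <? m) * ∑ (suc ((m ∸ suc r) ⊓ (l ∸ suc r))) f ≡ ∑ (suc (m ⊓ l)) (λ c → χ (r <? c) * f (c ∸ suc r))
χ*∑-shift r m l f r<l with r <? m
... | no r≮m = sym (∑-0 (suc (m ⊓ l)) (λ c c≤m⊓l → cong (_* f (c ∸ suc r)) (χ-no (r <? c) (r≮c c c≤m⊓l))))
  where
  r≮c : ∀ c → c < suc (m ⊓ l) → ¬ r < c
  r≮c c c≤m⊓l r<c = r≮m (≤-trans r<c (≤-trans (s≤s⁻¹ c≤m⊓l) (m⊓n≤m m l)))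
... | yes r<m = begin
  1 * ∑ (suc ((m ∸ suc r) ⊓ (l ∸ suc r))) f  ≡⟨ *-identityˡ _ ⟩
  ∑ (suc ((m ∸ suc r) ⊓ (l ∸ suc r))) f      ≡⟨ cong (λ z → ∑ z f) (suc-⊓-∸ m l r r<m r<l) ⟩
  ∑ (a ∸ r) f                                ≡⟨ ∑-cong (a ∸ r) (λ k _ → sym (shifted k)) ⟩
  0 + ∑ (a ∸ r) (λ k → h (suc r + k))        ≡⟨ cong (_+ ∑ (a ∸ r) (λ k → h (suc r + k))) (sym (∑-0 (suc r) low)) ⟩
  ∑ (suc r) h + ∑ (a ∸ r) (λ k → h (suc r + k)) ≡⟨ sym (∑-split (suc r) (a ∸ r) h) ⟩
  ∑ (suc r + (a ∸ r)) h                      ≡⟨ cong (λ z → ∑ (suc z) h) (m+[n∸m]≡n (<⇒≤ (⊓-glb r<m r<l))) ⟩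
  ∑ (suc a) h                                ∎
  where
  open ≡-Reasoning
  a = m ⊓ l
  h = λ c → χ (r <? c) * f (c ∸ suc r)
  shifted : ∀ k → h (suc r + k) ≡ f k
  shifted k = begin
    χ (r <? suc r + k) * f (suc r + k ∸ suc r) ≡⟨ cong (_* f (suc r + k ∸ suc r)) (χ-yes (r <? suc r + k) (s≤s (m≤m+n r k))) ⟩
    1 * f (suc r + k ∸ suc r)                  ≡⟨ *-identityˡ _ ⟩
    f (suc r + k ∸ suc r)                      ≡⟨ cong f (m+n∸m≡n (suc r) k) ⟩
    f k                                        ∎
  low : ∀ c → c < suc r → h c ≡ 0
  low c c≤r = cong (_* f (c ∸ suc r)) (χ-no (r <? c) (λ r<c → <-irrefl refl (≤-trans r<c (s≤s⁻¹ c≤r))))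

cornerCount-∷ : ∀ i m l ls → Decreasing (l ∷ ls) →
  cornerCount (3 + i) m (l ∷ ls) ≡ ∑ (suc (m ⊓ l)) (λ c → cornerCount (2 + i) c ls)
cornerCount-∷ i m l ls d =
  χ*-∑ (r <? row ls (suc i)) (suc (m ⊓ l)) _ (λ c → χ (r <? c) * (below * count (c ∸ suc r) above)) λ r<ri →
    trans (cong (χ (r <? m) *_) (sym (∑-*ˡ (suc ((m ∸ suc r) ⊓ (l ∸ suc r))) below (λ c → count c above))))
          (χ*∑-shift r m l (λ c → below * count c above) (r<l r<ri))
  where
  r = row ls (2 + i)
  below = countUncapped (drop (2 + i) ls)
  above = map (_∸ suc r) (take (suc i) ls)
  r<l : r < row ls (suc i) → r < l
  r<l r<ri = <-≤-trans r<ri (≤-trans (row≤row-1 ls (suc i) (Linked.tail d)) (decreasing-next d))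

count-deleteRow-suc : ∀ i m λ′ → Decreasing λ′ →
  count m (deleteRow (2 + i) λ′) ≡ count m (deleteRow (suc i) λ′) + cornerCount (2 + i) m λ′
count-deleteRow-suc zero    m λ′       d = count-deleteRow-2 m λ′ d
count-deleteRow-suc (suc i) m []       d = refl
count-deleteRow-suc (suc i) m (l ∷ ls) d = begin
  ∑ (suc a) (λ c → count c (deleteRow (2 + i) ls))
    ≡⟨ ∑-cong (suc a) (λ c _ → count-deleteRow-suc i c ls (Linked.tail d)) ⟩
  ∑ (suc a) (λ c → count c (deleteRow (suc i) ls) + cornerCount (2 + i) c ls)
    ≡⟨ ∑-+ (suc a) (λ c → count c (deleteRow (suc i) ls)) (λ c → cornerCount (2 + i) c ls) ⟩
  count m (l ∷ deleteRow (suc i) ls) + ∑ (suc a) (λ c → cornerCount (2 + i) c ls)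
    ≡⟨ cong (count m (l ∷ deleteRow (suc i) ls) +_) (sym (cornerCount-∷ i m l ls d)) ⟩
  count m (l ∷ deleteRow (suc i) ls) + cornerCount (3 + i) m (l ∷ ls) ∎
  where
  open ≡-Reasoning
  a = m ⊓ l

count-deleteRow-telescope : ∀ n k m λ′ → Decreasing λ′ →
  count m (deleteRow (suc k) λ′) + ∑ n (λ t → cornerCount (2 + (k + t)) m λ′) ≡ count m (deleteRow (suc (k + n)) λ′)
count-deleteRow-telescope zero    k m λ′ d =
  trans (+-identityʳ _) (cong (λ z → count m (deleteRow (suc z) λ′)) (sym (+-identityʳ k)))
count-deleteRow-telescope (suc n) k m λ′ d = begin
  count m (deleteRow (suc k) λ′) + ∑ (suc n) G        ≡⟨ cong (count m (deleteRow (suc k) λ′) +_) (∑-last n G) ⟩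
  count m (deleteRow (suc k) λ′) + (∑ n G + G n)      ≡⟨ sym (+-assoc (count m (deleteRow (suc k) λ′)) _ _) ⟩
  count m (deleteRow (suc k) λ′) + ∑ n G + G n        ≡⟨ cong (_+ G n) (count-deleteRow-telescope n k m λ′ d) ⟩
  count m (deleteRow (suc (k + n)) λ′) + G n          ≡⟨ sym (count-deleteRow-suc (k + n) m λ′ d) ⟩
  count m (deleteRow (2 + (k + n)) λ′)                ≡⟨ cong (λ z → count m (deleteRow (suc z) λ′)) (sym (+-suc k n)) ⟩
  count m (deleteRow (suc (k + suc n)) λ′)            ∎
  where
  open ≡-Reasoning
  G = λ t → cornerCount (2 + (k + t)) m λ′

∑count-deleteRow+∑corners : ∀ m λ′ → Decreasing λ′ →
  ∑count-deleteRow m λ′ + ∑ (length λ′) (λ k → ∑ (length λ′ ∸ k) (λ t → cornerCount (2 + (k + t)) m λ′))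
    ≡ length λ′ * count m λ′
∑count-deleteRow+∑corners m λ′ d = begin
  ∑count-deleteRow m λ′ + ∑ L (λ k → ∑ (L ∸ k) (λ t → G (k + t)))
    ≡⟨ sym (∑-+ L (λ k → count m (deleteRow (suc k) λ′)) (λ k → ∑ (L ∸ k) (λ t → G (k + t)))) ⟩
  ∑ L (λ k → count m (deleteRow (suc k) λ′) + ∑ (L ∸ k) (λ t → G (k + t)))
    ≡⟨ ∑-cong L (λ k k<L → trans (count-deleteRow-telescope (L ∸ k) k m λ′ d)
                                  (cong (λ z → count m (deleteRow (suc z) λ′)) (m+[n∸m]≡n (<⇒≤ k<L)))) ⟩
  ∑ L (λ _ → count m (deleteRow (suc L) λ′))
    ≡⟨ cong (λ z → ∑ L (λ _ → count m z)) (deleteRow-beyond λ′) ⟩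
  ∑ L (λ _ → count m λ′)
    ≡⟨ ∑-const L (count m λ′) ⟩
  L * count m λ′ ∎
  where
  open ≡-Reasoning
  L = length λ′
  G = λ u → cornerCount (2 + u) m λ′

count⁺¹≡∑cornerCount : ∀ m λ′ → Decreasing λ′ →
  count⁺¹ m λ′ ≡ ∑ (length λ′) (λ u → suc u * cornerCount (2 + u) m λ′)
count⁺¹≡∑cornerCount m λ′ d = begin
  count⁺¹ m λ′ ≡⟨ +-cancelʳ-≡ _ _ _ (trans (count⁺¹+∑deleteRow≡length*count m λ′ d)
                                          (sym (trans (+-comm Y _) (∑count-deleteRow+∑corners m λ′ d)))) ⟩
  Y            ≡⟨ ∑-triangle L (λ u → cornerCount (2 + u) m λ′) ⟩
  ∑ L (λ u → suc u * cornerCount (2 + u) m λ′) ∎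
  where
  open ≡-Reasoning
  L = length λ′
  Y = ∑ L (λ k → ∑ (L ∸ k) (λ t → cornerCount (2 + (k + t)) m λ′))

-- Flagged fillings row by row

flaggedCells : ℕ → List Entry
flaggedCells i = subsets (applyUpTo suc (suc i))

∈-flaggedCells⇒≤ : ∀ i {s} → s ∈ flaggedCells i → All (_≤ suc i) s
∈-flaggedCells⇒≤ i s∈ = All.map ≤bound (∈-subsets⁻ _ s∈)
  where
  ≤bound : ∀ {v} → v ∈ applyUpTo suc (suc i) → v ≤ suc i
  ≤bound v∈ with _ , u<n , refl ← ∈-applyUpTo⁻ suc v∈ = u<n

∈-flaggedCells⇒pos : ∀ i {s} → s ∈ flaggedCells i → All (0 <_) s
∈-flaggedCells⇒pos i s∈ = All.map pos (∈-subsets⁻ _ s∈)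
  where
  pos : ∀ {v} → v ∈ applyUpTo suc (suc i) → 0 < v
  pos v∈ with _ , _ , refl ← ∈-applyUpTo⁻ suc v∈ = z<s

applyUpTo-suc-sorted : ∀ n → AllPairs _<_ (applyUpTo suc n)
applyUpTo-suc-sorted n = AllPairs.applyUpTo⁺₁ suc n (λ i<j _ → s<s i<j)

∈-flaggedCells⇒sorted : ∀ i {s} → s ∈ flaggedCells i → AllPairs _<_ s
∈-flaggedCells⇒sorted i = subsets-sorted _ (applyUpTo-suc-sorted (suc i))

flaggedCells-unique : ∀ i → Unique (flaggedCells i)
flaggedCells-unique i = subsets-unique _ (applyUpTo-suc-sorted (suc i))

flaggedRows : ℕ → ℕ → List (List Entry)
flaggedRows i l = tuples (flaggedCells i) l

flaggedFillingsFrom-∷ : ∀ i l ls → flaggedFillingsFrom i (l ∷ ls) ≡ conses (flaggedRows i l) (flaggedFillingsFrom (suc i) ls)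
flaggedFillingsFrom-∷ i l ls = concatMap-conses (flaggedRows i l) _

∈-flaggedFillingsFrom-shape : ∀ i ls {T} → T ∈ flaggedFillingsFrom i ls → map length T ≡ ls
∈-flaggedFillingsFrom-shape i []       (here refl) = refl
∈-flaggedFillingsFrom-shape i (l ∷ ls) {T} T∈
  with r , T′ , r∈ , T′∈ , refl ← ∈-cartesianProductWith⁻ _∷_ (flaggedRows i l) (flaggedFillingsFrom (suc i) ls)
                                    (subst (T ∈_) (flaggedFillingsFrom-∷ i l ls) T∈)
  = cong₂ _∷_ (proj₁ (∈-tuples⁻ _ l r∈)) (∈-flaggedFillingsFrom-shape (suc i) ls T′∈)

ColRel-trans : ∀ a b c → ColRel a b → ColRel b c → All NonEmptySet b → length c ≤ length b → ColRel a c
ColRel-trans []      b       c       _        _        _          _         = []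
ColRel-trans (x ∷ a) b       []      _        _        _          _         = []
ColRel-trans (x ∷ a) (y ∷ b) (z ∷ c) (x<y ∷ p) (y<z ∷ q) (y≢[] ∷ ne) (s≤s lc) =
  cell-trans y y≢[] x<y y<z ∷ ColRel-trans a b c p q ne lc
  where
  cell-trans : ∀ y → NonEmptySet y → StrictLT x y → StrictLT y z → StrictLT x z
  cell-trans (v ∷ _) _ x<y y<z = All.map (λ u<y → All.map (<-trans (All.head u<y)) (All.head y<z)) x<y

ShorterThan : List Entry → Filling → Set
ShorterThan r T = All (λ t → length t ≤ length r) T

All-ColRel-trans : ∀ a b T → ColRel a b → All (ColRel b) T → All NonEmptySet b → ShorterThan b T → All (ColRel a) T
All-ColRel-trans a b []      _   _          _  _          = []
All-ColRel-trans a b (t ∷ T) a<b (b<t ∷ b<T) ne (|t| ∷ |T|) =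
  ColRel-trans a b t a<b b<t ne |t| ∷ All-ColRel-trans a b T a<b b<T ne |T|

#twos : List ℕ → ℕ
#twos xs = length (filter (_≟ 2) xs)

OnesAndTwos : List ℕ → Set
OnesAndTwos = All (λ s → s ≡ 1 ⊎ s ≡ 2)

#twos-++ : ∀ xs ys → #twos (xs ++ ys) ≡ #twos xs + #twos ys
#twos-++ xs ys = trans (cong length (filter-++ (_≟ 2) xs ys)) (length-++ (filter (_≟ 2) xs))

ones⇒#twos≡0 : ∀ {xs} → All (_≡ 1) xs → #twos xs ≡ 0
ones⇒#twos≡0 ones = cong length (filter-none (_≟ 2) (All.map (λ { refl () }) ones))

#twos≡0⇒ones : ∀ xs → OnesAndTwos xs → #twos xs ≡ 0 → All (_≡ 1) xs
#twos≡0⇒ones []       _               _  = []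
#twos≡0⇒ones (x ∷ xs) (inj₁ refl ∷ a) e  = refl ∷ #twos≡0⇒ones xs a e
#twos≡0⇒ones (x ∷ xs) (inj₂ refl ∷ a) ()

m+n≡1 : ∀ m n → m + n ≡ 1 → (m ≡ 1 × n ≡ 0) ⊎ (m ≡ 0 × n ≡ 1)
m+n≡1 zero          n       e = inj₂ (refl , e)
m+n≡1 (suc zero)    zero    e = inj₁ (refl , refl)

SetValuedRow : List Entry → Set
SetValuedRow r = All NonEmptySet r × AllPairs WeakLE r

CSRow : List Entry → Set
CSRow r = SetValuedRow r × All (_≡ 1) (map length r)

BarelyRow : List Entry → Set
BarelyRow r = SetValuedRow r × OnesAndTwos (map length r) × #twos (map length r) ≡ 1

CSRowUnder : List Entry → List Entry → Set
CSRowUnder prev r = CSRow r × ColRel prev r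

BarelyRowUnder : List Entry → List Entry → Set
BarelyRowUnder prev r = BarelyRow r × ColRel prev r

-- IsSetValued asks ColRel of every pair of rows, not only of adjacent ones.
CSTUnder : List Entry → Filling → Set
CSTUnder prev T = IsColumnStrictTableau T × All (ColRel prev) T

BarelyUnder : List Entry → Filling → Set
BarelyUnder prev T = IsBarelySetValued T × All (ColRel prev) T

setValuedRow? : ∀ r → Dec (SetValuedRow r)
setValuedRow? r = all? nonEmpty? r ×-dec allPairs? weakLE? r

csRowUnder? : ∀ prev r → Dec (CSRowUnder prev r)
csRowUnder? prev r = (setValuedRow? r ×-dec all? (_≟ 1) (map length r)) ×-dec colRel? prev r

barelyRowUnder? : ∀ prev r → Dec (BarelyRowUnder prev r)
barelyRowUnder? prev r =
  (setValuedRow? r ×-dec (all? (λ s → (s ≟ 1) ⊎-dec (s ≟ 2)) (map length r) ×-dec (#twos (map length r) ≟ 1)))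
  ×-dec colRel? prev r

cstUnder? : ∀ prev T → Dec (CSTUnder prev T)
cstUnder? prev T = isCST? T ×-dec all? (colRel? prev) T

barelyUnder? : ∀ prev T → Dec (BarelyUnder prev T)
barelyUnder? prev T = isBarely? T ×-dec all? (colRel? prev) T

CSTUnder-∷⇔ : ∀ prev r T → ShorterThan r T →
  CSTUnder prev (r ∷ T) ⇔ (CSRowUnder prev r × CSTUnder r T)
CSTUnder-∷⇔ prev r T shorter = mk⇔ to from
  where
  to : CSTUnder prev (r ∷ T) → CSRowUnder prev r × CSTUnder r T
  to (((ne ∷ nes , w ∷ ws , c ∷ cs) , ones) , p<r ∷ _) with onesʳ , onesᵀ ← all-++⁻ (map length r) ones =
    (((ne , w) , onesʳ) , p<r) , (((nes , ws , cs) , onesᵀ) , c)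
  from : CSRowUnder prev r × CSTUnder r T → CSTUnder prev (r ∷ T)
  from ((((ne , w) , onesʳ) , p<r) , (((nes , ws , cs) , onesᵀ) , c)) =
    ((ne ∷ nes , w ∷ ws , c ∷ cs) , all-++⁺ onesʳ onesᵀ) , p<r ∷ All-ColRel-trans prev r T p<r c ne shorter

BarelyUnder-∷⇔ : ∀ prev r T → ShorterThan r T →
  BarelyUnder prev (r ∷ T) ⇔ ((BarelyRowUnder prev r × CSTUnder r T) ⊎ (CSRowUnder prev r × BarelyUnder r T))
BarelyUnder-∷⇔ prev r T shorter = mk⇔ to from
  where
  to : BarelyUnder prev (r ∷ T) → (BarelyRowUnder prev r × CSTUnder r T) ⊎ (CSRowUnder prev r × BarelyUnder r T)
  to (((ne ∷ nes , w ∷ ws , c ∷ cs) , sizes , one) , p<r ∷ _)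
    with sizesʳ , sizesᵀ ← all-++⁻ (map length r) sizes
    with m+n≡1 (#twos (map length r)) (#twos (cellSizes T)) (trans (sym (#twos-++ (map length r) (cellSizes T))) one)
  ... | inj₁ (oneʳ , noneᵀ) =
    inj₁ ((((ne , w) , sizesʳ , oneʳ) , p<r) , (((nes , ws , cs) , #twos≡0⇒ones _ sizesᵀ noneᵀ) , c))
  ... | inj₂ (noneʳ , oneᵀ) =
    inj₂ ((((ne , w) , #twos≡0⇒ones _ sizesʳ noneʳ) , p<r) , (((nes , ws , cs) , sizesᵀ , oneᵀ) , c))
  from : (BarelyRowUnder prev r × CSTUnder r T) ⊎ (CSRowUnder prev r × BarelyUnder r T) → BarelyUnder prev (r ∷ T)
  from (inj₁ ((((ne , w) , sizesʳ , oneʳ) , p<r) , (((nes , ws , cs) , onesᵀ) , c))) =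
    ((ne ∷ nes , w ∷ ws , c ∷ cs) , all-++⁺ sizesʳ (All.map inj₁ onesᵀ) ,
      trans (#twos-++ (map length r) (cellSizes T)) (cong₂ _+_ oneʳ (ones⇒#twos≡0 onesᵀ))) ,
    p<r ∷ All-ColRel-trans prev r T p<r c ne shorter
  from (inj₂ ((((ne , w) , onesʳ) , p<r) , (((nes , ws , cs) , sizesᵀ , oneᵀ) , c))) =
    ((ne ∷ nes , w ∷ ws , c ∷ cs) , all-++⁺ (All.map inj₁ onesʳ) sizesᵀ ,
      trans (#twos-++ (map length r) (cellSizes T)) (cong₂ _+_ (ones⇒#twos≡0 onesʳ) oneᵀ)) ,
    p<r ∷ All-ColRel-trans prev r T p<r c ne shorter

¬BarelyRow×CSRow : ∀ {r} → ¬ (BarelyRow r × CSRow r)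
¬BarelyRow×CSRow ((_ , _ , one) , (_ , ones)) with () ← trans (sym one) (ones⇒#twos≡0 ones)

lowCell∈ : ∀ b → (suc b ∷ []) ∈ flaggedCells (suc b)
lowCell∈ b = ∈-subsets⁺ ([f_k]⊆applyUpTo suc (2 + b) b (m<n+m b (s≤s z≤n)))

highCell∈ : ∀ b → (2 + b ∷ []) ∈ flaggedCells (suc b)
highCell∈ b = ∈-subsets⁺ ([f_k]⊆applyUpTo suc (2 + b) (suc b) ≤-refl)

pairCell∈ : ∀ b → (suc b ∷ 2 + b ∷ []) ∈ flaggedCells (suc b)
pairCell∈ b = ∈-subsets⁺ ([f_k,f_k+1]⊆applyUpTo suc (2 + b) b ≤-refl)

canonicalRow : ℕ → ℕ → ℕ → List Entry
canonicalRow i zero    k       = []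
canonicalRow i (suc n) zero    = (suc i ∷ []) ∷ canonicalRow i n zero
canonicalRow i (suc n) (suc k) = (i ∷ []) ∷ canonicalRow i n k

canonicalRow⁺¹ : ℕ → ℕ → ℕ → List Entry
canonicalRow⁺¹ i zero    k       = []
canonicalRow⁺¹ i (suc n) zero    = (i ∷ suc i ∷ []) ∷ canonicalRow i n zero
canonicalRow⁺¹ i (suc n) (suc k) = (i ∷ []) ∷ canonicalRow⁺¹ i n k

length-canonicalRow : ∀ i n k → length (canonicalRow i n k) ≡ n
length-canonicalRow i zero    k       = refl
length-canonicalRow i (suc n) zero    = cong suc (length-canonicalRow i n zero)
length-canonicalRow i (suc n) (suc k) = cong suc (length-canonicalRow i n k)

length-canonicalRow⁺¹ : ∀ i n k → length (canonicalRow⁺¹ i n k) ≡ n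
length-canonicalRow⁺¹ i zero    k       = refl
length-canonicalRow⁺¹ i (suc n) zero    = cong suc (length-canonicalRow i n zero)
length-canonicalRow⁺¹ i (suc n) (suc k) = cong suc (length-canonicalRow⁺¹ i n k)

-- r can be placed under the infinite row b^m (b+1)(b+1)…
FitsUnder : ℕ → ℕ → List Entry → Set
FitsUnder m       b []      = ⊤
FitsUnder zero    b (s ∷ r) = All (suc b <_) s × FitsUnder zero b r
FitsUnder (suc m) b (s ∷ r) = All (b <_) s × FitsUnder m b r

FitsUnder⇒head> : ∀ m b {s r} → FitsUnder m b (s ∷ r) → All (b <_) s
FitsUnder⇒head> zero    b (s> , _) = All.map (<-trans (n<1+n b)) s>
FitsUnder⇒head> (suc m) b (s> , _) = s>

single-high : ∀ m b {v r} → (v ∷ []) ∈ flaggedCells (suc b) → FitsUnder m b ((v ∷ []) ∷ r) → v ≢ suc b → v ≡ 2 + b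
single-high m b v∈ fits v≢ =
  ≤-antisym (All.head (∈-flaggedCells⇒≤ (suc b) v∈)) (≤∧≢⇒< (All.head (FitsUnder⇒head> m b fits)) (v≢ ∘ sym))

weakLE-single⇒≤ : ∀ {v u r} → v ≡ u → All (WeakLE (v ∷ [])) r → All (All (u ≤_)) r
weakLE-single⇒≤ refl = All.map All.head

all-high : ∀ b r → All (_∈ flaggedCells (suc b)) r → All (_≡ 1) (map length r) → All (All (2 + b ≤_)) r →
  r ≡ canonicalRow (suc b) (length r) zero
all-high b []             _         _          _              = refl
all-high b ((x ∷ []) ∷ r) (x∈ ∷ r∈) (refl ∷ 1s) ((b< ∷ []) ∷ r≥) =
  cong₂ _∷_ (cong (_∷ []) (≤-antisym (All.head (∈-flaggedCells⇒≤ (suc b) x∈)) b<)) (all-high b r r∈ 1s r≥)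

-- The cells equal to b + 1 come first and use up the cap m; the first other
-- cell is b + 2, and weak increase along the row forces all later ones to be b + 2.
csRow-canonical : ∀ b m r → All (_∈ flaggedCells (suc b)) r → CSRow r → FitsUnder m b r →
  ∃ λ k → k < suc (m ⊓ length r) × r ≡ canonicalRow (suc b) (length r) k
csRow-canonical b m [] _ _ _ = 0 , z<s , refl
csRow-canonical b m ((v ∷ []) ∷ r) (v∈ ∷ r∈) ((_ ∷ nes , w ∷ ws) , refl ∷ 1s) fits with v ≟ suc b
csRow-canonical b zero    ((v ∷ []) ∷ r) _ _ ((b< ∷ []) , _) | yes refl = ⊥-elim (<-irrefl refl b<)
csRow-canonical b (suc m) ((v ∷ []) ∷ r) (_ ∷ r∈) ((_ ∷ nes , _ ∷ ws) , _ ∷ 1s) (_ , fits) | yes refl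
  with k , k≤ , r≡ ← csRow-canonical b m r r∈ ((nes , ws) , 1s) fits = suc k , s<s k≤ , cong (_ ∷_) r≡
... | no v≢ = 0 , z<s , cong₂ _∷_ (cong (_∷ []) v≡) (all-high b r r∈ 1s (weakLE-single⇒≤ v≡ w))
  where v≡ = single-high m b v∈ fits v≢

high-cell-length≤1 : ∀ b {s} → s ∈ flaggedCells (suc b) → All (2 + b ≤_) s → length s ≤ 1
high-cell-length≤1 b {[]}         _  _               = z≤n
high-cell-length≤1 b {x ∷ []}     _  _               = ≤-refl
high-cell-length≤1 b {x ∷ y ∷ s} s∈ (b<x ∷ _ ∷ _)
  with (x<y ∷ _) ∷ _ ← ∈-flaggedCells⇒sorted (suc b) s∈ | _ ∷ y≤ ∷ _ ← ∈-flaggedCells⇒≤ (suc b) s∈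
  = ⊥-elim (<-irrefl refl (<-≤-trans (≤-<-trans b<x x<y) y≤))

no-twos-high : ∀ b r → All (_∈ flaggedCells (suc b)) r → All (All (2 + b ≤_)) r → #twos (map length r) ≡ 0
no-twos-high b r r∈ r≥ = cong length (filter-none (_≟ 2) (all-map⁺ (All.zipWith ≤1⇒≢2 (r∈ , r≥))))
  where
  ≤1⇒≢2 : ∀ {s} → s ∈ flaggedCells (suc b) × All (2 + b ≤_) s → length s ≢ 2
  ≤1⇒≢2 (s∈ , s≥) |s|≡2 = <-irrefl refl (subst (_≤ 1) |s|≡2 (high-cell-length≤1 b s∈ s≥))

pair-cell : ∀ b {x y} → (x ∷ y ∷ []) ∈ flaggedCells (suc b) → b < x → x ≡ suc b × y ≡ 2 + b
pair-cell b xy∈ b<x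
  with (x<y ∷ []) ∷ _ ← ∈-flaggedCells⇒sorted (suc b) xy∈ | _ ∷ y≤ ∷ [] ← ∈-flaggedCells⇒≤ (suc b) xy∈
  = x≡ , ≤-antisym y≤ (subst (_< _) x≡ x<y)
  where x≡ = ≤-antisym (s≤s⁻¹ (<-≤-trans x<y y≤)) b<x

-- As for csRow-canonical, except that the first cell other than b + 1 must be
-- {b + 1, b + 2}: a row that reaches b + 2 has no room for a two-element cell.
barelyRow-canonical : ∀ b m r → All (_∈ flaggedCells (suc b)) r → BarelyRow r → FitsUnder m b r →
  ∃ λ k → k < m ⊓ length r × r ≡ canonicalRow⁺¹ (suc b) (length r) k
barelyRow-canonical b m [] _ (_ , _ , ()) _
barelyRow-canonical b m ((v ∷ []) ∷ r) (v∈ ∷ r∈) ((_ ∷ nes , w ∷ ws) , _ ∷ sizes , one) fits with v ≟ suc b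
barelyRow-canonical b zero    ((v ∷ []) ∷ r) _ _ ((b< ∷ []) , _) | yes refl = ⊥-elim (<-irrefl refl b<)
barelyRow-canonical b (suc m) ((v ∷ []) ∷ r) (_ ∷ r∈) ((_ ∷ nes , _ ∷ ws) , _ ∷ sizes , one) (_ , fits) | yes refl
  with k , k< , r≡ ← barelyRow-canonical b m r r∈ ((nes , ws) , sizes , one) fits = suc k , s<s k< , cong (_ ∷_) r≡
... | no v≢ = ⊥-elim (0≢1+n (trans (sym (no-twos-high b r r∈ (weakLE-single⇒≤ v≡ w))) one))
  where v≡ = single-high m b v∈ fits v≢
barelyRow-canonical b zero ((x ∷ y ∷ []) ∷ r) (xy∈ ∷ _) _ ((b+1<x ∷ _) , _) =
  ⊥-elim (<-irrefl (sym (proj₁ (pair-cell b xy∈ (<-trans (n<1+n b) b+1<x)))) b+1<x)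
barelyRow-canonical b (suc m) ((x ∷ y ∷ []) ∷ r) (xy∈ ∷ r∈) ((_ , w ∷ _) , _ ∷ sizes , one) ((b<x ∷ _) , _)
  with refl , refl ← pair-cell b xy∈ b<x =
  0 , z<s , cong (_ ∷_) (all-high b r r∈ (#twos≡0⇒ones _ sizes (suc-injective one)) (All.map (All.head ∘ All.tail) w))
barelyRow-canonical b m ((_ ∷ _ ∷ _ ∷ _) ∷ r) _ (_ , inj₁ () ∷ _ , _) _
barelyRow-canonical b m ((_ ∷ _ ∷ _ ∷ _) ∷ r) _ (_ , inj₂ () ∷ _ , _) _

canonicalRow-cells : ∀ i n k → All (λ s → s ≡ i ∷ [] ⊎ s ≡ suc i ∷ []) (canonicalRow i n k)
canonicalRow-cells i zero    k       = []
canonicalRow-cells i (suc n) zero    = inj₂ refl ∷ canonicalRow-cells i n zero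
canonicalRow-cells i (suc n) (suc k) = inj₁ refl ∷ canonicalRow-cells i n k

canonicalRow-high : ∀ i n → All (_≡ suc i ∷ []) (canonicalRow i n zero)
canonicalRow-high i zero    = []
canonicalRow-high i (suc n) = refl ∷ canonicalRow-high i n

canonicalRow-weakLE : ∀ i n k → AllPairs WeakLE (canonicalRow i n k)
canonicalRow-weakLE i zero    k       = []
canonicalRow-weakLE i (suc n) zero    =
  All.map (λ { refl → (≤-refl ∷ []) ∷ [] }) (canonicalRow-high i n) ∷ canonicalRow-weakLE i n zero
canonicalRow-weakLE i (suc n) (suc k) =
  All.map (λ { (inj₁ refl) → (≤-refl ∷ []) ∷ [] ; (inj₂ refl) → (n≤1+n i ∷ []) ∷ [] }) (canonicalRow-cells i n k)
  ∷ canonicalRow-weakLE i n k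

canonicalRow-csRow : ∀ i n k → CSRow (canonicalRow i n k)
canonicalRow-csRow i n k =
  (All.map (λ { (inj₁ refl) → z<s ; (inj₂ refl) → z<s }) (canonicalRow-cells i n k) , canonicalRow-weakLE i n k) ,
  all-map⁺ (All.map (λ { (inj₁ refl) → refl ; (inj₂ refl) → refl }) (canonicalRow-cells i n k))

canonicalRow-∈ : ∀ b n k → All (_∈ flaggedCells (suc b)) (canonicalRow (suc b) n k)
canonicalRow-∈ b n k = All.map (λ { (inj₁ refl) → lowCell∈ b ; (inj₂ refl) → highCell∈ b }) (canonicalRow-cells (suc b) n k)

canonicalRow-high-fits : ∀ b m n → FitsUnder m b (canonicalRow (suc b) n zero)
canonicalRow-high-fits b m       zero    = tt
canonicalRow-high-fits b zero    (suc n) = (≤-refl ∷ []) , canonicalRow-high-fits b zero n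
canonicalRow-high-fits b (suc m) (suc n) = (m<n+m b (s≤s z≤n) ∷ []) , canonicalRow-high-fits b m n

canonicalRow-fits : ∀ b m n k → k ≤ m → FitsUnder m b (canonicalRow (suc b) n k)
canonicalRow-fits b m       zero    k       _         = tt
canonicalRow-fits b m       (suc n) zero    _         = canonicalRow-high-fits b m (suc n)
canonicalRow-fits b (suc m) (suc n) (suc k) (s≤s k≤m) = (≤-refl ∷ []) , canonicalRow-fits b m n k k≤m

canonicalRow-injective : ∀ i n k k′ → k < k′ → k′ ≤ n → canonicalRow i n k ≢ canonicalRow i n k′
canonicalRow-injective i (suc n) zero    (suc k′) _         _         ()
canonicalRow-injective i (suc n) (suc k) (suc k′) (s<s k<k′) (s≤s k′≤n) e =
  canonicalRow-injective i n k k′ k<k′ k′≤n (proj₂ (∷-injective e))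

CellOfRow⁺¹ : ℕ → Entry → Set
CellOfRow⁺¹ i s = s ≡ i ∷ [] ⊎ s ≡ suc i ∷ [] ⊎ s ≡ i ∷ suc i ∷ []

canonicalRow⁺¹-cells : ∀ i n k → All (CellOfRow⁺¹ i) (canonicalRow⁺¹ i n k)
canonicalRow⁺¹-cells i zero    k       = []
canonicalRow⁺¹-cells i (suc n) zero    =
  inj₂ (inj₂ refl) ∷ All.map (λ { (inj₁ e) → inj₁ e ; (inj₂ e) → inj₂ (inj₁ e) }) (canonicalRow-cells i n zero)
canonicalRow⁺¹-cells i (suc n) (suc k) = inj₁ refl ∷ canonicalRow⁺¹-cells i n k

canonicalRow⁺¹-weakLE : ∀ i n k → AllPairs WeakLE (canonicalRow⁺¹ i n k)
canonicalRow⁺¹-weakLE i zero    k       = []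
canonicalRow⁺¹-weakLE i (suc n) zero    =
  All.map (λ { refl → (n≤1+n i ∷ []) ∷ (≤-refl ∷ []) ∷ [] }) (canonicalRow-high i n) ∷ canonicalRow-weakLE i n zero
canonicalRow⁺¹-weakLE i (suc n) (suc k) =
  All.map (λ { (inj₁ refl) → (≤-refl ∷ []) ∷ []
             ; (inj₂ (inj₁ refl)) → (n≤1+n i ∷ []) ∷ []
             ; (inj₂ (inj₂ refl)) → (≤-refl ∷ n≤1+n i ∷ []) ∷ [] })
          (canonicalRow⁺¹-cells i n k)
  ∷ canonicalRow⁺¹-weakLE i n k

#twos-canonicalRow⁺¹ : ∀ i n k → k < n → #twos (map length (canonicalRow⁺¹ i n k)) ≡ 1
#twos-canonicalRow⁺¹ i (suc n) zero    _         = cong suc (ones⇒#twos≡0 (proj₂ (canonicalRow-csRow i n zero)))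
#twos-canonicalRow⁺¹ i (suc n) (suc k) (s<s k<n) = #twos-canonicalRow⁺¹ i n k k<n

canonicalRow⁺¹-barelyRow : ∀ i n k → k < n → BarelyRow (canonicalRow⁺¹ i n k)
canonicalRow⁺¹-barelyRow i n k k<n =
  (All.map (λ { (inj₁ refl) → z<s ; (inj₂ (inj₁ refl)) → z<s ; (inj₂ (inj₂ refl)) → z<s }) cells ,
   canonicalRow⁺¹-weakLE i n k) ,
  all-map⁺ (All.map (λ { (inj₁ refl) → inj₁ refl ; (inj₂ (inj₁ refl)) → inj₁ refl ; (inj₂ (inj₂ refl)) → inj₂ refl }) cells) ,
  #twos-canonicalRow⁺¹ i n k k<n
  where cells = canonicalRow⁺¹-cells i n k

canonicalRow⁺¹-∈ : ∀ b n k → All (_∈ flaggedCells (suc b)) (canonicalRow⁺¹ (suc b) n k)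
canonicalRow⁺¹-∈ b n k =
  All.map (λ { (inj₁ refl) → lowCell∈ b ; (inj₂ (inj₁ refl)) → highCell∈ b ; (inj₂ (inj₂ refl)) → pairCell∈ b })
          (canonicalRow⁺¹-cells (suc b) n k)

canonicalRow⁺¹-fits : ∀ b m n k → k < m → FitsUnder m b (canonicalRow⁺¹ (suc b) n k)
canonicalRow⁺¹-fits b m       zero    k       _         = tt
canonicalRow⁺¹-fits b (suc m) (suc n) zero    _         =
  (n<1+n b ∷ m<n+m b (s≤s z≤n) ∷ []) , canonicalRow-high-fits b m n
canonicalRow⁺¹-fits b (suc m) (suc n) (suc k) (s<s k<m) = (≤-refl ∷ []) , canonicalRow⁺¹-fits b m n k k<m

canonicalRow⁺¹-injective : ∀ i n k k′ → k < k′ → k′ < n → canonicalRow⁺¹ i n k ≢ canonicalRow⁺¹ i n k′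
canonicalRow⁺¹-injective i (suc n) zero    (suc k′) _          _          ()
canonicalRow⁺¹-injective i (suc n) (suc k) (suc k′) (s<s k<k′) (s<s k′<n) e =
  canonicalRow⁺¹-injective i n k k′ k<k′ k′<n (proj₂ (∷-injective e))

-- R and R⁺¹ as iterated sums

-- As the row above a row r of length ≤ bound with entries from row b + 1, prev
-- restricts r exactly as the row b^m (b+1)(b+1)… would.
ConstrainsLike : List Entry → ℕ → ℕ → ℕ → Set
ConstrainsLike prev m b bound =
  ∀ r → length r ≤ bound → All (_∈ flaggedCells (suc b)) r → ColRel prev r ⇔ FitsUnder m b r

canonicalRow-constrains : ∀ b n k → ConstrainsLike (canonicalRow (suc b) n k) k (suc b) n
canonicalRow-constrains b zero    k       []      _         _         = mk⇔ (λ _ → tt) (λ _ → [])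
canonicalRow-constrains b (suc n) zero    []      _         _         = mk⇔ (λ _ → tt) (λ _ → [])
canonicalRow-constrains b (suc n) (suc k) []      _         _         = mk⇔ (λ _ → tt) (λ _ → [])
canonicalRow-constrains b (suc n) zero    (s ∷ r) (s≤s |r|) (_ ∷ r∈) =
  mk⇔ (λ { (s> ∷ r>) → All.head s> , Equivalence.to ih r> }) (λ { (s> , r>) → (s> ∷ []) ∷ Equivalence.from ih r> })
  where ih = canonicalRow-constrains b n zero r |r| r∈
canonicalRow-constrains b (suc n) (suc k) (s ∷ r) (s≤s |r|) (_ ∷ r∈) =
  mk⇔ (λ { (s> ∷ r>) → All.head s> , Equivalence.to ih r> }) (λ { (s> , r>) → (s> ∷ []) ∷ Equivalence.from ih r> })
  where ih = canonicalRow-constrains b n k r |r| r∈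

canonicalRow⁺¹-constrains : ∀ b n k → ConstrainsLike (canonicalRow⁺¹ (suc b) n k) k (suc b) n
canonicalRow⁺¹-constrains b zero    k       []      _         _         = mk⇔ (λ _ → tt) (λ _ → [])
canonicalRow⁺¹-constrains b (suc n) zero    []      _         _         = mk⇔ (λ _ → tt) (λ _ → [])
canonicalRow⁺¹-constrains b (suc n) (suc k) []      _         _         = mk⇔ (λ _ → tt) (λ _ → [])
canonicalRow⁺¹-constrains b (suc n) zero    (s ∷ r) (s≤s |r|) (_ ∷ r∈) =
  mk⇔ (λ { (s> ∷ r>) → All.head (All.tail s>) , Equivalence.to ih r> })
      (λ { (s> , r>) → (All.map (<-trans (n<1+n (suc b))) s> ∷ s> ∷ []) ∷ Equivalence.from ih r> })
  where ih = canonicalRow-constrains b n zero r |r| r∈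
canonicalRow⁺¹-constrains b (suc n) (suc k) (s ∷ r) (s≤s |r|) (_ ∷ r∈) =
  mk⇔ (λ { (s> ∷ r>) → All.head s> , Equivalence.to ih r> }) (λ { (s> , r>) → (s> ∷ []) ∷ Equivalence.from ih r> })
  where ih = canonicalRow⁺¹-constrains b n k r |r| r∈

-- The first row has nothing above it: it behaves like a row of λ_1 zeros.
top-constrains : ∀ m → ConstrainsLike [] m 0 m
top-constrains m r |r| r∈ = mk⇔ (λ _ → fits m r |r| r∈) (λ _ → [])
  where
  fits : ∀ m r → length r ≤ m → All (_∈ flaggedCells 1) r → FitsUnder m 0 r
  fits m       []      _         _        = tt
  fits (suc m) (s ∷ r) (s≤s |r|) (s∈ ∷ r∈) = ∈-flaggedCells⇒pos 1 s∈ , fits m r |r| r∈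

module _ {prev m b bound} (constrains : ConstrainsLike prev m b bound) {n} (n≤bound : n ≤ bound) where

  private
    rows = flaggedRows (suc b) n
    canonical = applyUpTo (canonicalRow (suc b) n) (suc (m ⊓ n))
    canonical⁺¹ = applyUpTo (canonicalRow⁺¹ (suc b) n) (m ⊓ n)

    rows-unique : Unique rows
    rows-unique = tuples-unique _ n (flaggedCells-unique (suc b))

    csRowsUnder≈canonical : ∀ r → r ∈ filter (csRowUnder? prev) rows ⇔ r ∈ canonical
    csRowsUnder≈canonical r = mk⇔ to from
      where
      to : r ∈ filter (csRowUnder? prev) rows → r ∈ canonical
      to r∈ with r∈rows , (cs , prev<r) ← ∈-filter⁻ (csRowUnder? prev) r∈
            with refl , r⊆ ← ∈-tuples⁻ _ n r∈rows
            with k , k≤ , r≡ ← csRow-canonical b m r r⊆ cs (Equivalence.to (constrains r n≤bound r⊆) prev<r)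
        = subst (_∈ _) (sym r≡) (∈-applyUpTo⁺ (canonicalRow (suc b) (length r)) k≤)
      from : r ∈ canonical → r ∈ filter (csRowUnder? prev) rows
      from r∈ with k , k≤ , refl ← ∈-applyUpTo⁻ (canonicalRow (suc b) n) r∈ =
        ∈-filter⁺ (csRowUnder? prev)
          (subst (λ z → canonicalRow (suc b) n k ∈ flaggedRows (suc b) z) |r| (∈-tuples⁺ _ _ r⊆))
          (canonicalRow-csRow (suc b) n k ,
           Equivalence.from (constrains _ (subst (_≤ bound) (sym |r|) n≤bound) r⊆)
                            (canonicalRow-fits b m n k (≤-trans (s≤s⁻¹ k≤) (m⊓n≤m m n))))
        where
        |r| = length-canonicalRow (suc b) n k
        r⊆ = canonicalRow-∈ b n k

    barelyRowsUnder≈canonical⁺¹ : ∀ r → r ∈ filter (barelyRowUnder? prev) rows ⇔ r ∈ canonical⁺¹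
    barelyRowsUnder≈canonical⁺¹ r = mk⇔ to from
      where
      to : r ∈ filter (barelyRowUnder? prev) rows → r ∈ canonical⁺¹
      to r∈ with r∈rows , (barely , prev<r) ← ∈-filter⁻ (barelyRowUnder? prev) r∈
            with refl , r⊆ ← ∈-tuples⁻ _ n r∈rows
            with k , k< , r≡ ← barelyRow-canonical b m r r⊆ barely (Equivalence.to (constrains r n≤bound r⊆) prev<r)
        = subst (_∈ _) (sym r≡) (∈-applyUpTo⁺ (canonicalRow⁺¹ (suc b) (length r)) k<)
      from : r ∈ canonical⁺¹ → r ∈ filter (barelyRowUnder? prev) rows
      from r∈ with k , k< , refl ← ∈-applyUpTo⁻ (canonicalRow⁺¹ (suc b) n) r∈ =
        ∈-filter⁺ (barelyRowUnder? prev)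
          (subst (λ z → canonicalRow⁺¹ (suc b) n k ∈ flaggedRows (suc b) z) |r| (∈-tuples⁺ _ _ r⊆))
          (canonicalRow⁺¹-barelyRow (suc b) n k (<-≤-trans k< (m⊓n≤n m n)) ,
           Equivalence.from (constrains _ (subst (_≤ bound) (sym |r|) n≤bound) r⊆)
                            (canonicalRow⁺¹-fits b m n k (<-≤-trans k< (m⊓n≤m m n))))
        where
        |r| = length-canonicalRow⁺¹ (suc b) n k
        r⊆ = canonicalRow⁺¹-∈ b n k

  sum-csRowsUnder : ∀ f → sum (map f (filter (csRowUnder? prev) rows)) ≡ ∑ (suc (m ⊓ n)) (f ∘ canonicalRow (suc b) n)
  sum-csRowsUnder f = trans
    (sum-map-setEq _ canonical f (filter⁺ (csRowUnder? prev) rows-unique) canonical-unique csRowsUnder≈canonical)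
    (sum-map-applyUpTo (canonicalRow (suc b) n) (suc (m ⊓ n)) f)
    where
    canonical-unique : Unique canonical
    canonical-unique = applyUpTo⁺₁ (canonicalRow (suc b) n) (suc (m ⊓ n))
      (λ k<k′ k′≤ → canonicalRow-injective (suc b) n _ _ k<k′ (≤-trans (s≤s⁻¹ k′≤) (m⊓n≤n m n)))

  sum-barelyRowsUnder : ∀ f → sum (map f (filter (barelyRowUnder? prev) rows)) ≡ ∑ (m ⊓ n) (f ∘ canonicalRow⁺¹ (suc b) n)
  sum-barelyRowsUnder f = trans
    (sum-map-setEq _ canonical⁺¹ f (filter⁺ (barelyRowUnder? prev) rows-unique) canonical⁺¹-unique barelyRowsUnder≈canonical⁺¹)
    (sum-map-applyUpTo (canonicalRow⁺¹ (suc b) n) (m ⊓ n) f)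
    where
    canonical⁺¹-unique : Unique canonical⁺¹
    canonical⁺¹-unique = applyUpTo⁺₁ (canonicalRow⁺¹ (suc b) n) (m ⊓ n)
      (λ k<k′ k′< → canonicalRow⁺¹-injective (suc b) n _ _ k<k′ (<-≤-trans k′< (m⊓n≤n m n)))

#cstUnder : List Entry → List Filling → ℕ
#cstUnder prev Ts = sum (map (χ ∘ cstUnder? prev) Ts)

#barelyUnder : List Entry → List Filling → ℕ
#barelyUnder prev Ts = sum (map (χ ∘ barelyUnder? prev) Ts)

#cstUnder-∷ : ∀ prev r F → (∀ T → T ∈ F → ShorterThan r T) →
  #cstUnder prev (map (r ∷_) F) ≡ χ (csRowUnder? prev r) * #cstUnder r F
#cstUnder-∷ prev r F shorter = begin
  sum (map (χ ∘ cstUnder? prev) (map (r ∷_) F))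
    ≡⟨ cong sum (sym (map-∘ F)) ⟩
  sum (map (λ T → χ (cstUnder? prev (r ∷ T))) F)
    ≡⟨ sum-map-cong F (λ T T∈ → trans (χ-⇔ _ _ (CSTUnder-∷⇔ prev r T (shorter T T∈)))
                                       (χ-×-dec (csRowUnder? prev r) (cstUnder? r T))) ⟩
  sum (map (λ T → χ (csRowUnder? prev r) * χ (cstUnder? r T)) F)
    ≡⟨ sum-map-*ˡ F (χ (csRowUnder? prev r)) (χ ∘ cstUnder? r) ⟩
  χ (csRowUnder? prev r) * #cstUnder r F ∎
  where open ≡-Reasoning

#barelyUnder-∷ : ∀ prev r F → (∀ T → T ∈ F → ShorterThan r T) →
  #barelyUnder prev (map (r ∷_) F) ≡ χ (barelyRowUnder? prev r) * #cstUnder r F + χ (csRowUnder? prev r) * #barelyUnder r F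
#barelyUnder-∷ prev r F shorter = begin
  sum (map (χ ∘ barelyUnder? prev) (map (r ∷_) F))
    ≡⟨ cong sum (sym (map-∘ F)) ⟩
  sum (map (λ T → χ (barelyUnder? prev (r ∷ T))) F)
    ≡⟨ sum-map-cong F (λ T T∈ → trans (χ-⇔ _ (either T) (BarelyUnder-∷⇔ prev r T (shorter T T∈)))
                                       (trans (χ-⊎-dec (firstRow T) (lowerRows T) exclusive)
                                              (cong₂ _+_ (χ-×-dec (barelyRowUnder? prev r) (cstUnder? r T))
                                                         (χ-×-dec (csRowUnder? prev r) (barelyUnder? r T))))) ⟩
  sum (map (λ T → χ (barelyRowUnder? prev r) * χ (cstUnder? r T) + χ (csRowUnder? prev r) * χ (barelyUnder? r T)) F)
    ≡⟨ sum-map-+ F _ _ ⟩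
  sum (map (λ T → χ (barelyRowUnder? prev r) * χ (cstUnder? r T)) F) +
  sum (map (λ T → χ (csRowUnder? prev r) * χ (barelyUnder? r T)) F)
    ≡⟨ cong₂ _+_ (sum-map-*ˡ F (χ (barelyRowUnder? prev r)) (χ ∘ cstUnder? r))
                 (sum-map-*ˡ F (χ (csRowUnder? prev r)) (χ ∘ barelyUnder? r)) ⟩
  χ (barelyRowUnder? prev r) * #cstUnder r F + χ (csRowUnder? prev r) * #barelyUnder r F ∎
  where
  open ≡-Reasoning
  firstRow = λ T → barelyRowUnder? prev r ×-dec cstUnder? r T
  lowerRows = λ T → csRowUnder? prev r ×-dec barelyUnder? r T
  either = λ T → firstRow T ⊎-dec lowerRows T
  exclusive : ∀ {T} → ¬ ((BarelyRowUnder prev r × CSTUnder r T) × (CSRowUnder prev r × BarelyUnder r T))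
  exclusive (((barely , _) , _) , ((cs , _) , _)) = ¬BarelyRow×CSRow (barely , cs)

lower-rows-shorter : ∀ {i l ls r T} → Decreasing (l ∷ ls) → r ∈ flaggedRows i l → T ∈ flaggedFillingsFrom (suc i) ls →
  ShorterThan r T
lower-rows-shorter {i} {l} {ls} {r} {T} d r∈ T∈ =
  all-map⁻ (subst (All (_≤ length r)) (sym (∈-flaggedFillingsFrom-shape (suc i) ls T∈))
                  (subst (λ z → All (_≤ z) ls) (sym (proj₁ (∈-tuples⁻ _ l r∈))) (All.tail (decreasing⇒≤head d))))

count-correct : ∀ ls b m bound prev → Decreasing ls → All (_≤ bound) ls → ConstrainsLike prev m b bound →
  #cstUnder prev (flaggedFillingsFrom (suc b) ls) ≡ count m ls
count-correct [] b m bound prev d _ _ = cong (_+ 0) (χ-yes (cstUnder? prev []) (((([] , [] , []) , []) , [])))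
count-correct (l ∷ ls) b m bound prev d (l≤ ∷ _) constrains = begin
  #cstUnder prev (flaggedFillingsFrom (suc b) (l ∷ ls))
    ≡⟨ cong (#cstUnder prev) (flaggedFillingsFrom-∷ (suc b) l ls) ⟩
  #cstUnder prev (conses rows F)
    ≡⟨ sum-map-conses rows F (χ ∘ cstUnder? prev) ⟩
  sum (map (λ r → #cstUnder prev (map (r ∷_) F)) rows)
    ≡⟨ sum-map-cong rows (λ r r∈ → #cstUnder-∷ prev r F (λ _ → lower-rows-shorter d r∈)) ⟩
  sum (map (λ r → χ (csRowUnder? prev r) * #cstUnder r F) rows)
    ≡⟨ sum-map-χ* (csRowUnder? prev) rows (λ r → #cstUnder r F) ⟩
  sum (map (λ r → #cstUnder r F) (filter (csRowUnder? prev) rows))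
    ≡⟨ sum-csRowsUnder constrains l≤ (λ r → #cstUnder r F) ⟩
  ∑ (suc (m ⊓ l)) (λ k → #cstUnder (canonicalRow (suc b) l k) F)
    ≡⟨ ∑-cong (suc (m ⊓ l)) (λ k _ → count-correct ls (suc b) k l _ (Linked.tail d) (All.tail (decreasing⇒≤head d))
                                                   (canonicalRow-constrains b l k)) ⟩
  count m (l ∷ ls) ∎
  where
  open ≡-Reasoning
  rows = flaggedRows (suc b) l
  F = flaggedFillingsFrom (2 + b) ls

count⁺¹-correct : ∀ ls b m bound prev → Decreasing ls → All (_≤ bound) ls → ConstrainsLike prev m b bound →
  #barelyUnder prev (flaggedFillingsFrom (suc b) ls) ≡ count⁺¹ m ls
count⁺¹-correct [] b m bound prev d _ _ = cong (_+ 0) (χ-no (barelyUnder? prev []) λ { ((_ , _ , ()) , _) })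
count⁺¹-correct (l ∷ ls) b m bound prev d (l≤ ∷ _) constrains = begin
  #barelyUnder prev (flaggedFillingsFrom (suc b) (l ∷ ls))
    ≡⟨ cong (#barelyUnder prev) (flaggedFillingsFrom-∷ (suc b) l ls) ⟩
  #barelyUnder prev (conses rows F)
    ≡⟨ sum-map-conses rows F (χ ∘ barelyUnder? prev) ⟩
  sum (map (λ r → #barelyUnder prev (map (r ∷_) F)) rows)
    ≡⟨ sum-map-cong rows (λ r r∈ → #barelyUnder-∷ prev r F (λ _ → lower-rows-shorter d r∈)) ⟩
  sum (map (λ r → χ (barelyRowUnder? prev r) * #cstUnder r F + χ (csRowUnder? prev r) * #barelyUnder r F) rows)
    ≡⟨ sum-map-+ rows _ _ ⟩
  sum (map (λ r → χ (barelyRowUnder? prev r) * #cstUnder r F) rows) +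
  sum (map (λ r → χ (csRowUnder? prev r) * #barelyUnder r F) rows)
    ≡⟨ cong₂ _+_ (sum-map-χ* (barelyRowUnder? prev) rows (λ r → #cstUnder r F))
                 (sum-map-χ* (csRowUnder? prev) rows (λ r → #barelyUnder r F)) ⟩
  sum (map (λ r → #cstUnder r F) (filter (barelyRowUnder? prev) rows)) +
  sum (map (λ r → #barelyUnder r F) (filter (csRowUnder? prev) rows))
    ≡⟨ cong₂ _+_ (sum-barelyRowsUnder constrains l≤ (λ r → #cstUnder r F))
                 (sum-csRowsUnder constrains l≤ (λ r → #barelyUnder r F)) ⟩
  ∑ (m ⊓ l) (λ k → #cstUnder (canonicalRow⁺¹ (suc b) l k) F) +
  ∑ (suc (m ⊓ l)) (λ k → #barelyUnder (canonicalRow (suc b) l k) F)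
    ≡⟨ cong₂ _+_ (∑-cong (m ⊓ l) (λ k _ → count-correct ls (suc b) k l _ d′ ls≤ (canonicalRow⁺¹-constrains b l k)))
                 (∑-cong (suc (m ⊓ l)) (λ k _ → count⁺¹-correct ls (suc b) k l _ d′ ls≤ (canonicalRow-constrains b l k))) ⟩
  count⁺¹ m (l ∷ ls) ∎
  where
  open ≡-Reasoning
  rows = flaggedRows (suc b) l
  F = flaggedFillingsFrom (2 + b) ls
  d′ = Linked.tail d
  ls≤ = All.tail (decreasing⇒≤head d)

under-empty-row⇔ : ∀ (P : Filling → Set) T → (P T × All (ColRel []) T) ⇔ P T
under-empty-row⇔ P T = mk⇔ proj₁ (_, All.universal (λ _ → []) T)

R≡count : ∀ λ′ → Decreasing λ′ → R λ′ ≡ countUncapped λ′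
R≡count λ′ d = begin
  length (filter isCST? (flaggedFillings λ′))
    ≡⟨ length-filter≡sum-χ isCST? (flaggedFillings λ′) ⟩
  sum (map (χ ∘ isCST?) (flaggedFillings λ′))
    ≡⟨ sum-map-cong (flaggedFillings λ′) (λ T _ → χ-⇔ _ _ (⇔-sym (under-empty-row⇔ IsColumnStrictTableau T))) ⟩
  #cstUnder [] (flaggedFillings λ′)
    ≡⟨ count-correct λ′ 0 (row λ′ 1) (row λ′ 1) [] d (≤row-1 λ′ d) (top-constrains (row λ′ 1)) ⟩
  countUncapped λ′ ∎
  where open ≡-Reasoning

R⁺¹≡count⁺¹ : ∀ λ′ → Decreasing λ′ → R⁺¹ λ′ ≡ count⁺¹ (row λ′ 1) λ′
R⁺¹≡count⁺¹ λ′ d = begin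
  length (filter isBarely? (flaggedFillings λ′))
    ≡⟨ length-filter≡sum-χ isBarely? (flaggedFillings λ′) ⟩
  sum (map (χ ∘ isBarely?) (flaggedFillings λ′))
    ≡⟨ sum-map-cong (flaggedFillings λ′) (λ T _ → χ-⇔ _ _ (⇔-sym (under-empty-row⇔ IsBarelySetValued T))) ⟩
  #barelyUnder [] (flaggedFillings λ′)
    ≡⟨ count⁺¹-correct λ′ 0 (row λ′ 1) (row λ′ 1) [] d (≤row-1 λ′ d) (top-constrains (row λ′ 1)) ⟩
  count⁺¹ (row λ′ 1) λ′ ∎
  where open ≡-Reasoning

-- Outside corners

-- addCell i λ adds a cell at the end of row i + 1.
addCell : ℕ → List ℕ → List ℕ
addCell zero    []       = 1 ∷ []
addCell zero    (x ∷ xs) = suc x ∷ xs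
addCell (suc i) []       = []
addCell (suc i) (x ∷ xs) = x ∷ addCell i xs

row-addCell-same : ∀ i λ′ → i ≤ length λ′ → row (addCell i λ′) (suc i) ≡ suc (row λ′ (suc i))
row-addCell-same zero    []       _          = refl
row-addCell-same zero    (x ∷ xs) _          = refl
row-addCell-same (suc i) (x ∷ xs) (s≤s i≤) = row-addCell-same i xs i≤

row-addCell-other : ∀ i k λ′ → k ≢ suc i → i ≤ length λ′ → row (addCell i λ′) k ≡ row λ′ k
row-addCell-other zero    zero          []       _   _          = refl
row-addCell-other zero    (suc zero)    []       k≢ _          = ⊥-elim (k≢ refl)
row-addCell-other zero    (suc (suc k)) []       _   _          = refl
row-addCell-other zero    zero          (x ∷ xs) _   _          = refl
row-addCell-other zero    (suc zero)    (x ∷ xs) k≢ _          = ⊥-elim (k≢ refl)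
row-addCell-other zero    (suc (suc k)) (x ∷ xs) _   _          = refl
row-addCell-other (suc i) zero          (x ∷ xs) _   _          = refl
row-addCell-other (suc i) (suc zero)    (x ∷ xs) _   _          = refl
row-addCell-other (suc i) (suc (suc k)) (x ∷ xs) k≢ (s≤s i≤) = row-addCell-other i (suc k) xs (k≢ ∘ cong suc) i≤

addCell-positive : ∀ i λ′ → All (0 <_) λ′ → All (0 <_) (addCell i λ′)
addCell-positive zero    []       _         = z<s ∷ []
addCell-positive zero    (x ∷ xs) (_ ∷ xs>) = z<s ∷ xs>
addCell-positive (suc i) []       _         = []
addCell-positive (suc i) (x ∷ xs) (x> ∷ xs>) = x> ∷ addCell-positive i xs xs>

-- Adding a cell to row i + 1 keeps λ a partition.
Extendable : List ℕ → ℕ → Set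
Extendable λ′ zero    = ⊤
Extendable λ′ (suc i) = row λ′ (2 + i) < row λ′ (suc i)

addCell-decreasing : ∀ i λ′ → Decreasing λ′ → i ≤ length λ′ → Extendable λ′ i → Decreasing (addCell i λ′)
addCell-decreasing zero          []       d _ _ = [-]
addCell-decreasing zero          (x ∷ xs) d _ _ = ∷-decreasing (Linked.tail d) (≤-trans (decreasing-next d) (n≤1+n x))
addCell-decreasing (suc zero)    (x ∷ xs) d _ r₂<x =
  ∷-decreasing (addCell-decreasing zero xs (Linked.tail d) z≤n tt) (row-1-addCell xs r₂<x)
  where
  row-1-addCell : ∀ xs → row xs 1 < x → row (addCell 0 xs) 1 ≤ x
  row-1-addCell []      r<x = r<x
  row-1-addCell (_ ∷ _) r<x = r<x
addCell-decreasing (suc (suc i)) (x ∷ y ∷ xs) d (s≤s i≤) ext =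
  ∷-decreasing (addCell-decreasing (suc i) (y ∷ xs) (Linked.tail d) i≤ ext) (decreasing-next d)

extendable⇒outsideCorner : ∀ λ′ → IsPartition λ′ → ∀ i → i ≤ length λ′ → Extendable λ′ i →
  IsOutsideCorner λ′ (suc i , suc (row λ′ (suc i)))
extendable⇒outsideCorner λ′ (d , pos) i i≤ ext =
  (λ (_ , _ , r<r) → <-irrefl refl r<r) , addCell i λ′ , (addCell-decreasing i λ′ d i≤ ext , addCell-positive i λ′ pos) , cells
  where
  r = row λ′ (suc i)
  cells : ∀ c → InDiagram (addCell i λ′) c ⇔ (InDiagram λ′ c ⊎ c ≡ (suc i , suc r))
  cells (k , j) with k ≟ suc i
  ... | yes refl = mk⇔ to from
    where
    same = row-addCell-same i λ′ i≤
    to : InDiagram (addCell i λ′) (suc i , j) → InDiagram λ′ (suc i , j) ⊎ (suc i , j) ≡ (suc i , suc r)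
    to (1≤i , 1≤j , j≤) with m≤n⇒m<n∨m≡n (subst (j ≤_) same j≤)
    ... | inj₁ j≤r  = inj₁ (1≤i , 1≤j , s≤s⁻¹ j≤r)
    ... | inj₂ refl = inj₂ refl
    from : InDiagram λ′ (suc i , j) ⊎ (suc i , j) ≡ (suc i , suc r) → InDiagram (addCell i λ′) (suc i , j)
    from (inj₁ (1≤i , 1≤j , j≤)) = 1≤i , 1≤j , subst (j ≤_) (sym same) (m≤n⇒m≤1+n j≤)
    from (inj₂ refl)             = s≤s z≤n , s≤s z≤n , subst (suc r ≤_) (sym same) ≤-refl
  ... | no k≢ = mk⇔ to from
    where
    other = row-addCell-other i k λ′ k≢ i≤
    to : InDiagram (addCell i λ′) (k , j) → InDiagram λ′ (k , j) ⊎ (k , j) ≡ (suc i , suc r)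
    to (1≤k , 1≤j , j≤) = inj₁ (1≤k , 1≤j , subst (j ≤_) other j≤)
    from : InDiagram λ′ (k , j) ⊎ (k , j) ≡ (suc i , suc r) → InDiagram (addCell i λ′) (k , j)
    from (inj₁ (1≤k , 1≤j , j≤)) = 1≤k , 1≤j , subst (j ≤_) (sym other) j≤
    from (inj₂ e)               = ⊥-elim (k≢ (cong proj₁ e))

-- The new cell (i, j) lies in the diagram μ ⊇ λ; (i, j - 1) must lie in λ (or j = 1),
-- and if i > 1 then (i - 1, j) lies in μ but is not the new cell.
outsideCorner⇒extendable : ∀ λ′ i j → IsOutsideCorner λ′ (i , j) →
  ∃ λ i′ → i ≡ suc i′ × i′ ≤ length λ′ × Extendable λ′ i′ × j ≡ suc (row λ′ i)
outsideCorner⇒extendable λ′ i j (∉λ , μ , (dμ , _) , μ≈)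
  with 1≤i , 1≤j , j≤μ ← Equivalence.from (μ≈ (i , j)) (inj₂ refl) = by-row i refl
  where
  r<j : row λ′ i < j
  r<j with j ≤? row λ′ i
  ... | yes j≤ = ⊥-elim (∉λ (1≤i , 1≤j , j≤))
  ... | no  j≰ = ≰⇒> j≰
  j≡ : j ≡ suc (row λ′ i)
  j≡ with j ≟ suc (row λ′ i)
  ... | yes e  = e
  ... | no  j≢ = ⊥-elim (left-neighbour (Equivalence.to (μ≈ (i , pred j)) (1≤i , ≤-trans z<s r<j-1 , ≤-trans pred[n]≤n j≤μ)))
    where
    1+[j-1]≡j : suc (pred j) ≡ j
    1+[j-1]≡j = suc-pred j {{>-nonZero 1≤j}}
    r<j-1 : row λ′ i < pred j
    r<j-1 = s≤s⁻¹ (subst (suc (row λ′ i) <_) (sym 1+[j-1]≡j) (≤∧≢⇒< r<j (j≢ ∘ sym)))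
    left-neighbour : InDiagram λ′ (i , pred j) ⊎ (i , pred j) ≡ (i , j) → ⊥
    left-neighbour (inj₁ (_ , _ , j-1≤r)) = <-irrefl refl (<-≤-trans r<j-1 j-1≤r)
    left-neighbour (inj₂ e)              = 1+n≢n (trans 1+[j-1]≡j (sym (cong proj₂ e)))
  by-row : ∀ k → i ≡ k → ∃ λ i′ → i ≡ suc i′ × i′ ≤ length λ′ × Extendable λ′ i′ × j ≡ suc (row λ′ i)
  by-row zero          i≡ with () ← subst (1 ≤_) i≡ 1≤i
  by-row (suc zero)    i≡ = 0 , i≡ , z≤n , tt , j≡
  by-row (suc (suc u)) i≡
    with Equivalence.to (μ≈ (suc u , j)) (s≤s z≤n , 1≤j , ≤-trans (subst (λ z → j ≤ row μ z) i≡ j≤μ) (row-suc-≤ μ dμ u))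
  ... | inj₂ e = ⊥-elim (1+n≢n (sym (trans (cong proj₁ e) i≡)))
  ... | inj₁ (_ , _ , j≤ru) = suc u , i≡ , u<length , subst (_≤ row λ′ (suc u)) (trans j≡ (cong (suc ∘ row λ′) i≡)) j≤ru , j≡
    where
    u<length : suc u ≤ length λ′
    u<length with suc u ≤? length λ′
    ... | yes u< = u<
    ... | no  u≮ = ⊥-elim (<-irrefl refl (<-≤-trans 1≤j (subst (j ≤_) (row-beyond λ′ u (s≤s⁻¹ (≰⇒> u≮))) j≤ru)))

cornerTerm≡cornerCount : ∀ λ′ → Decreasing λ′ → ∀ u →
  χ (row λ′ (2 + u) <? row λ′ (suc u)) * cornerTerm λ′ (2 + u , suc (row λ′ (2 + u)))
    ≡ suc u * cornerCount (2 + u) (row λ′ 1) λ′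
cornerTerm≡cornerCount []       d u = sym (*-zeroʳ (suc u))
cornerTerm≡cornerCount (l ∷ ls) d u with row (l ∷ ls) (2 + u) <? row (l ∷ ls) (suc u)
... | no _    = sym (*-zeroʳ (suc u))
... | yes r<ru = begin
  1 * (suc u * R below * R above)
    ≡⟨ *-identityˡ _ ⟩
  suc u * R below * R above
    ≡⟨ cong₂ (λ x y → suc u * x * y) (R≡count below below-decreasing) (R≡count above above-decreasing) ⟩
  suc u * countUncapped below * count (l ∸ suc r) above
    ≡⟨ *-assoc (suc u) (countUncapped below) (count (l ∸ suc r) above) ⟩
  suc u * P
    ≡⟨ cong (suc u *_) (sym (trans (*-identityˡ _) (trans χ≡1 (*-identityˡ P)))) ⟩
  suc u * (1 * (χ (r <? l) * P)) ∎
  where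
  open ≡-Reasoning
  r = row (l ∷ ls) (2 + u)
  below = drop (2 + u) (l ∷ ls)
  above = map (_∸ suc r) (take (suc u) (l ∷ ls))
  P = countUncapped below * count (l ∸ suc r) above
  below-decreasing = drop-decreasing (2 + u) (l ∷ ls) d
  above-decreasing = ∸-decreasing (suc r) _ (take-decreasing (suc u) (l ∷ ls) d)
  χ≡1 : χ (r <? l) * P ≡ 1 * P
  χ≡1 = cong (_* P) (χ-yes (r <? l) (<-≤-trans r<ru (row≤row-1 (l ∷ ls) (suc u) d)))

module _ (λ′ : List ℕ) where

  private
    extendable? : ∀ u → Dec (Extendable λ′ (suc u))
    extendable? u = row λ′ (2 + u) <? row λ′ (suc u)

    lowerCorner : ℕ → Cell
    lowerCorner u = (2 + u , suc (row λ′ (2 + u)))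

  outsideCorners : List Cell
  outsideCorners = (1 , suc (row λ′ 1)) ∷ map lowerCorner (filter extendable? (upTo (length λ′)))

  ∈-outsideCorners⇔ : IsPartition λ′ → ∀ x → x ∈ outsideCorners ⇔ IsOutsideCorner λ′ x
  ∈-outsideCorners⇔ λ-partition (i , j) = mk⇔ to from
    where
    to : (i , j) ∈ outsideCorners → IsOutsideCorner λ′ (i , j)
    to (here refl) = extendable⇒outsideCorner λ′ λ-partition 0 z≤n tt
    to (there x∈)
      with u , u∈ , refl ← ∈-map⁻ lowerCorner x∈
      with u<L , ext ← ∈-filter⁻ extendable? u∈
      = extendable⇒outsideCorner λ′ λ-partition (suc u) (∈-upTo⁻ u<L) ext
    from : IsOutsideCorner λ′ (i , j) → (i , j) ∈ outsideCorners
    from corner with outsideCorner⇒extendable λ′ i j corner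
    ... | zero  , refl , _  , _   , refl = here refl
    ... | suc u , refl , u< , ext , refl = there (∈-map⁺ lowerCorner (∈-filter⁺ extendable? (∈-upTo⁺ u<) ext))

  outsideCorners-unique : Unique outsideCorners
  outsideCorners-unique =
    All.tabulate first≢lower ∷ unique-map⁺ (cong (pred ∘ pred ∘ proj₁)) (filter⁺ extendable? (upTo⁺ (length λ′)))
    where
    first≢lower : ∀ {y} → y ∈ map lowerCorner (filter extendable? (upTo (length λ′))) → (1 , suc (row λ′ 1)) ≢ y
    first≢lower y∈ e with _ , _ , refl ← ∈-map⁻ lowerCorner y∈ with () ← cong proj₁ e

  -- The corner in row 1 carries the factor i - 1 = 0, so its term vanishes.
  sum-cornerTerm : Decreasing λ′ →
    sum (map (cornerTerm λ′) outsideCorners) ≡ ∑ (length λ′) (λ u → suc u * cornerCount (2 + u) (row λ′ 1) λ′)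
  sum-cornerTerm d = begin
    sum (map (cornerTerm λ′) (map lowerCorner (filter extendable? (upTo L))))
      ≡⟨ cong sum (sym (map-∘ (filter extendable? (upTo L)))) ⟩
    sum (map (cornerTerm λ′ ∘ lowerCorner) (filter extendable? (upTo L)))
      ≡⟨ sym (sum-map-χ* extendable? (upTo L) (cornerTerm λ′ ∘ lowerCorner)) ⟩
    sum (map (λ u → χ (extendable? u) * cornerTerm λ′ (lowerCorner u)) (upTo L))
      ≡⟨ sum-map-applyUpTo id L (λ u → χ (extendable? u) * cornerTerm λ′ (lowerCorner u)) ⟩
    ∑ L (λ u → χ (extendable? u) * cornerTerm λ′ (lowerCorner u))
      ≡⟨ ∑-cong L (λ u _ → cornerTerm≡cornerCount λ′ d u) ⟩
    ∑ L (λ u → suc u * cornerCount (2 + u) (row λ′ 1) λ′) ∎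
    where
    open ≡-Reasoning
    L = length λ′

corollary3p15 : (λ′ : List ℕ) → IsPartition λ′ →
    (cs : List Cell) → Unique cs → (∀ x → x ∈ cs ⇔ IsOutsideCorner λ′ x) →
    R⁺¹ λ′ ≡ sum (map (cornerTerm λ′) cs)
corollary3p15 λ′ λ-partition@(d , _) cs cs-unique cs≈corners = begin
  R⁺¹ λ′                                         ≡⟨ R⁺¹≡count⁺¹ λ′ d ⟩
  count⁺¹ (row λ′ 1) λ′                          ≡⟨ count⁺¹≡∑cornerCount (row λ′ 1) λ′ d ⟩
  ∑ (length λ′) (λ u → suc u * cornerCount (2 + u) (row λ′ 1) λ′)
                                                 ≡⟨ sum-cornerTerm λ′ d ⟨
  sum (map (cornerTerm λ′) (outsideCorners λ′))  ≡⟨ sum-map-setEq _ cs (cornerTerm λ′) (outsideCorners-unique λ′) cs-unique same ⟩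
  sum (map (cornerTerm λ′) cs)                   ∎
  where
  open ≡-Reasoning
  same : ∀ x → x ∈ outsideCorners λ′ ⇔ x ∈ cs
  same x = ⇔-trans (∈-outsideCorners⇔ λ′ λ-partition x) (⇔-sym (cs≈corners x))
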